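{- If $D$ is a digraph with no directed cycle of length at least $2$, then $U_D$ is $p$-positive, i.e., all coefficients of $U_D$ in the power sum basis are nonnegative. Consequently, for any permutation $\sigma$ and any poset $P$, the functions $U_\sigma$ and $U_P$ are $p$-positive.
   Context: Redei-Berge function of a digraph. Let $X=(V,E)$ be a digraph with finite $V$, $|V|=n$, $E\subseteq V\times V$ (loops allowed). A $V$-listing is a bijection $\pi:[n]\to V$, and $X\mathrm{Des}(\pi)=\{i\in[n-1]:(\pi_i,\pi_{i+1})\in E\}$. The fundamental quasisymmetric function is $F_I=\sum_{i_1\le\dots\le i_n,\ i_j<i_{j+1}\ (j\in I)}x_{i_1}\cdots x_{i_n}$. Then $U_X=\sum_{\pi}F_{X\mathrm{Des}(\pi)}$, a symmetric function. Power sums. The power sum basis is $p_\lambda=p_{\lambda_1}\cdots p_{\lambda_k}$ with $p_i=\sum_j x_j^i$. Posets and permutations. - For a poset $P$ on $[n]$, $U_P=U_{D_P}$, where $D_P$ is the digraph on $[n]$ with edges $(i,j)$ for $i<_Pj$. - For a permutation $\sigma\in S_n$, $U_\sigma=U_{P_\sigma}$, where $i<_{P_\sigma}j$ if and only if $i<j$ and $\sigma(i)<\sigma(j)$. -}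

module Defs where

open import Data.Nat as ℕ using (ℕ; zero; suc; _≤ᵇ_; _<ᵇ_)
open import Data.Fin as Fin using (Fin; zero; suc; toℕ; inject₁; fromℕ)
open import Data.Fin.Permutation using (Permutation′; _⟨$⟩ʳ_)
open import Data.Bool using (Bool; true; false; _∧_; _∨_; not; if_then_else_)
open import Data.List as List using (List; []; _∷_; map; concatMap; allFin; foldr; length)
open import Data.List.Relation.Unary.All using (All)
open import Data.List.Relation.Unary.Linked using (Linked)
open import Data.Product using (_×_; _,_; ∃; Σ-syntax)
open import Data.Integer using (+_)
open import Data.Rational as ℚ using (ℚ; 0ℚ; _/_)
open import Function.Definitions using (Injective)
open import Relation.Nullary using (¬_; Dec; does)
open import Relation.Binary using (Decidable; IsPartialOrder)
open import Relation.Binary.PropositionalEquality using (_≡_)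

-- Digraphs on the vertex set Fin n (loops allowed), with decidable
-- edge relation (needed to compute descent sets constructively).

record Digraph (n : ℕ) : Set₁ where
  field
    Edge  : Fin n → Fin n → Set
    edge? : Decidable Edge
open Digraph public

-- A directed cycle of length k = suc (suc m) ≥ 2: k distinct vertices
-- v₀ → v₁ → … → v_{k-1} → v₀.
record DirectedCycle {n : ℕ} (X : Digraph n) (m : ℕ) : Set where
  field
    vtx      : Fin (suc (suc m)) → Fin n
    distinct : Injective _≡_ _≡_ vtx
    step     : ∀ (i : Fin (suc m)) → Edge X (vtx (inject₁ i)) (vtx (suc i))
    close    : Edge X (vtx (fromℕ (suc m))) (vtx zero)

NoDirectedCycle≥2 : ∀ {n} → Digraph n → Set
NoDirectedCycle≥2 X = ∀ m → ¬ DirectedCycle X m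

funs : (a b : ℕ) → List (Fin a → Fin b)
funs zero    b = (λ ()) ∷ []
funs (suc a) b = concatMap (λ f → map (λ y → ext y f) (allFin b)) (funs a b)
  where
  ext : Fin b → (Fin a → Fin b) → Fin (suc a) → Fin b
  ext y f zero    = y
  ext y f (suc i) = f i

all : ∀ {A : Set} → (A → Bool) → List A → Bool
all P = foldr (λ x r → P x ∧ r) true

count : ∀ {A : Set} → (A → Bool) → List A → ℕ
count P = foldr (λ x r → if P x then suc r else r) 0

_==_ : ∀ {k} → Fin k → Fin k → Bool
i == j = does (i Fin.≟ j)

injB : ∀ {a b} → (Fin a → Fin b) → Bool
injB {a} f = all (λ i → all (λ j → not (f i == f j) ∨ (i == j)) (allFin a)) (allFin a)

adjPairs : (n : ℕ) → List (Fin n × Fin n)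
adjPairs zero    = []
adjPairs (suc m) = map (λ k → inject₁ k , suc k) (allFin m)

sumℕ : List ℕ → ℕ
sumℕ = foldr ℕ._+_ 0

sumℚ : List ℚ → ℚ
sumℚ = foldr ℚ._+_ 0ℚ

toℚ : ℕ → ℚ
toℚ k = + k / 1

-- Polynomials in N variables x_0..x_{N-1} are described by their
-- coefficient of the monomial x^α, α : Fin N → ℕ.

-- does the sequence s : Fin d → Fin N (i.e. x_{s 0} ⋯ x_{s (d-1)})
-- have exponent vector α ?
hasContent : ∀ {d N} → (Fin d → Fin N) → (Fin N → ℕ) → Bool
hasContent {d} {N} s α =
  all (λ k → count (λ j → s j == k) (allFin d) ℕ.≡ᵇ α k) (allFin N)

-- s weakly increasing, strictly increasing at each position j with
-- (π j, π (j+1)) ∈ E, i.e. at each j ∈ XDes(π).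
compatible : ∀ {n N} → Digraph n → (Fin n → Fin n) → (Fin n → Fin N) → Bool
compatible {n} X π s =
  all (λ { (j , j') →
         (toℕ (s j) ≤ᵇ toℕ (s j'))
         ∧ (not (does (edge? X (π j) (π j'))) ∨ (toℕ (s j) <ᵇ toℕ (s j'))) })
      (adjPairs n)

-- [x^α] U_X(x_0,…,x_{N-1}) = Σ_π [x^α] F_{XDes(π)}(x_0,…,x_{N-1}),
-- π ranging over V-listings (bijections Fin n → Fin n).
coeffU : ∀ {n} → Digraph n → (N : ℕ) → (Fin N → ℕ) → ℕ
coeffU {n} X N α =
  sumℕ (map (λ π → if injB π
                    then count (λ s → compatible X π s ∧ hasContent s α) (funs n N)
                    else 0)
            (funs n n))

-- [x^α] p_λ(x_0,…,x_{N-1}), p_λ = ∏_j (Σ_k x_k^{λ_j}): count the choices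
-- f : (parts of λ) → variables whose product is x^α.
coeffP : List ℕ → (N : ℕ) → (Fin N → ℕ) → ℕ
coeffP λs N α =
  count (λ f → all (λ k → sumℕ (map (λ j → if f j == k then List.lookup λs j else 0)
                                      (allFin (length λs)))
                           ℕ.≡ᵇ α k)
                   (allFin N))
        (funs (length λs) N)

IsPartition : ℕ → List ℕ → Set
IsPartition n λs = All (1 ℕ.≤_) λs × Linked ℕ._≥_ λs × sumℕ λs ≡ n

-- U_X is p-positive: U_X = Σ c_λ p_λ (finite sum over partitions of n) with
-- all c_λ ≥ 0, as an identity of symmetric functions, i.e. in every
-- finite number N of variables.
PPositive : ∀ {n} → Digraph n → Set
PPositive {n} X =
  ∃ λ (L : List (List ℕ × ℚ)) →
    All (λ { (λs , c) → IsPartition n λs × 0ℚ ℚ.≤ c }) L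
    × (∀ (N : ℕ) (α : Fin N → ℕ) →
         toℚ (coeffU X N α) ≡ sumℚ (map (λ { (λs , c) → c ℚ.* toℚ (coeffP λs N α) }) L))

record FinPoset (n : ℕ) : Set₁ where
  field
    _≤P_      : Fin n → Fin n → Set
    isPO      : IsPartialOrder _≡_ _≤P_
    _≤P?_     : Decidable _≤P_
open FinPoset public

posetDigraph : ∀ {n} → FinPoset n → Digraph n
posetDigraph P = record
  { Edge  = λ i j → (_≤P_ P i j) × ¬ (i ≡ j)
  ; edge? = λ i j → dec× (_≤P?_ P i j) (dec¬ (i Fin.≟ j)) }
  where
  open import Relation.Nullary.Decidable using () renaming (_×-dec_ to dec×; ¬? to dec¬)

-- P_σ : i <_{P_σ} j iff i < j and σ(i) < σ(j); U_σ = U_{D_{P_σ}}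
permDigraph : ∀ {n} → Permutation′ n → Digraph n
permDigraph σ = record
  { Edge  = λ i j → (i Fin.< j) × ((σ ⟨$⟩ʳ i) Fin.< (σ ⟨$⟩ʳ j))
  ; edge? = λ i j → (i Fin.<? j) ×-dec ((σ ⟨$⟩ʳ i) Fin.<? (σ ⟨$⟩ʳ j)) }
  where
  open import Relation.Nullary.Decidable using (_×-dec_)

-- Let v₀ be a source of a vertex set R: no other vertex of R has an edge into v₀. The coefficient
-- of x^α in U_R counts the listings of R cut into consecutive runs (no edge from a vertex to the
-- next one) of lengths α₀, α₁, …. Split the run containing v₀ at v₀: as nothing has an edge into
-- v₀, the part before v₀ is an arbitrary run avoiding v₀, and it can be moved past the run ρ that
-- starts at v₀. Hence U_R = Σ_ρ p_{|ρ|} U_{R ∖ ρ}, over the runs ρ starting at v₀. Without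
-- directed cycles of length ≥ 2 every nonempty R has a source, so iterating writes U as a sum of
-- power sums with coefficients in ℕ. Posets and permutations give transitive antisymmetric
-- digraphs, which have no such cycles.

{-# OPTIONS --safe #-}
module Submission where

open import Defs
open import Data.Bool using (Bool; true; false; _∧_; _∨_; not; if_then_else_)
import Data.Bool.Properties as Boolₚ
open import Data.Bool.Properties
  using (T-≡; ¬-not; ∨-conicalˡ; ∧-comm; ∧-commutativeMonoid; ∧-zeroʳ; ∧-identityʳ; ∨-zeroʳ; ∨-identityʳ)
open import Data.Empty using (⊥-elim)
open import Data.Fin as Fin using (Fin; zero; suc; toℕ)
open import Data.Fin.Patterns using (0F; 1F; 2F; 3F; 4F)
open import Data.Fin.Permutation using (Permutation′)
open import Data.Fin.Properties using (toℕ<n; any?)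
import Data.Fin.Properties as Finₚ
import Data.Integer as ℤ
import Data.Integer.Properties as ℤₚ
open import Data.List as List using (List; []; _∷_; map; concatMap; allFin; length; tabulate; _++_)
open import Data.List.Properties using (map-++; map-tabulate; length-tabulate)
open import Data.List.Relation.Binary.Permutation.Propositional using (_↭_; prep; swap; ↭-sym)
  renaming (refl to ↭-refl; trans to ↭-trans)
open import Data.List.Relation.Binary.Permutation.Propositional.Properties using (All-resp-↭)
open import Data.List.Relation.Unary.All as All using (All; []; _∷_)
open import Data.List.Relation.Unary.All.Properties using (concat⁺; map⁺; tabulate⁺)
open import Data.Maybe using (Maybe; just; nothing)
open import Data.Nat as ℕ using (ℕ; zero; suc; _+_; _∸_; _≤_; _<_; z≤n; s≤s; _≤ᵇ_; _<ᵇ_; _≡ᵇ_; _<?_)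
import Data.Nat.Coprimality as Coprimeₚ
open import Data.Nat.Induction using (<-rec)
open import Data.Nat.ListAction.Properties using (sum-++; sum-↭)
open import Data.Nat.Properties
open import Data.Product using (_×_; _,_; proj₁; proj₂; ∃)
open import Data.Rational as ℚ using (0ℚ; 1ℚ)
import Data.Rational.Properties as ℚₚ
open import Data.Rational.Unnormalised as ℚᵘ using (mkℚᵘ)
import Data.Rational.Unnormalised.Properties as ℚᵘₚ
open import Data.Unit using (⊤; tt)
open import Data.Vec using ([]; _∷_)
open import Function using (_∘_; id; _⇔_; mk⇔; Equivalence)
open import Function.Definitions using (Injective)
open import Relation.Binary using (Rel; Transitive; IsPartialOrder; tri<; tri≈; tri>)
open import Relation.Binary.Properties.DecTotalOrder ≤-decTotalOrder using (≥-decTotalOrder)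
open import Data.List.Sort ≥-decTotalOrder using (sort; sort-↭; sort-↗)
open import Relation.Binary.PropositionalEquality
open import Relation.Nullary.Decidable
  using (Dec; yes; no; does; _×-dec_; ¬?; decidable-stable; dec-true; dec-false; does-⇔)
open import Relation.Nullary.Negation using (¬_)
open import Algebra.Bundles using (CommutativeMonoid)
open import Algebra.Properties.CommutativeMonoid.Sum +-0-commutativeMonoid
  using (sum; sum-syntax; sum-cong-≗; ∑-distrib-+; ∑-comm; sum-replicate-zero)
open import Algebra.Properties.CommutativeSemigroup +-commutativeSemigroup
  using () renaming (x∙yz≈y∙xz to x+[y+z]≡y+[x+z]; x∙yz≈y∙zx to x+[y+z]≡y+[z+x])
open import Algebra.Properties.CommutativeSemigroup (CommutativeMonoid.commutativeSemigroup ∧-commutativeMonoid)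
  using () renaming (interchange to ∧-interchange)
import Algebra.Solver.CommutativeMonoid as CMSolver

open ≡-Reasoning

private
  variable
    A B : Set

infixr 7 _⊙_

_⊙_ : Bool → ℕ → ℕ
b ⊙ x = if b then x else 0

∧-⊙ : ∀ a b x → (a ∧ b) ⊙ x ≡ a ⊙ b ⊙ x
∧-⊙ true  b x = refl
∧-⊙ false b x = refl

⊙-distrib-+ : ∀ b x y → b ⊙ (x + y) ≡ b ⊙ x + b ⊙ y
⊙-distrib-+ true  x y = refl
⊙-distrib-+ false x y = refl

⊙-zeroʳ : ∀ b → b ⊙ 0 ≡ 0
⊙-zeroʳ true  = refl
⊙-zeroʳ false = refl

⊙-comm : ∀ a b x → a ⊙ b ⊙ x ≡ b ⊙ a ⊙ x
⊙-comm true  b x = refl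
⊙-comm false b x = sym (⊙-zeroʳ b)

⊙-cong-true : ∀ b {x y} → (b ≡ true → x ≡ y) → b ⊙ x ≡ b ⊙ y
⊙-cong-true true  x≡y = x≡y refl
⊙-cong-true false x≡y = refl

⊙-⊙-cong : ∀ a {b} a′ {b′ x} → a ∧ b ≡ a′ ∧ b′ → a ⊙ b ⊙ x ≡ a′ ⊙ b′ ⊙ x
⊙-⊙-cong a {b} a′ {b′} {x} eq = trans (sym (∧-⊙ a b x)) (trans (cong (_⊙ x) eq) (∧-⊙ a′ b′ x))

∧-true₁ : ∀ {a b} → a ∧ b ≡ true → a ≡ true
∧-true₁ {true} _ = refl

∧-true₂ : ∀ {a b} → a ∧ b ≡ true → b ≡ true
∧-true₂ {true} ab = ab

not-true : ∀ {b} → not b ≡ true → b ≡ false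
not-true {false} _ = refl

true≢false : true ≢ false
true≢false ()

Bool-ext : ∀ {a b} → (a ≡ true → b ≡ true) → (b ≡ true → a ≡ true) → a ≡ b
Bool-ext {true}  {true}  a⇒b b⇒a = refl
Bool-ext {true}  {false} a⇒b b⇒a = sym (a⇒b refl)
Bool-ext {false} {true}  a⇒b b⇒a = b⇒a refl
Bool-ext {false} {false} a⇒b b⇒a = refl

module _ {k : ℕ} where

  ==-refl : (i : Fin k) → (i == i) ≡ true
  ==-refl i = dec-true (i Fin.≟ i) refl

  ==-sym : (i j : Fin k) → (i == j) ≡ (j == i)
  ==-sym i j = does-⇔ (mk⇔ sym sym) (i Fin.≟ j) (j Fin.≟ i)

  ==⇒≡ : {i j : Fin k} → (i == j) ≡ true → i ≡ j
  ==⇒≡ {i} {j} h with i Fin.≟ j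
  ... | yes i≡j = i≡j

  ==-false⇒≢ : {i j : Fin k} → (i == j) ≡ false → i ≢ j
  ==-false⇒≢ {i} h refl = true≢false (trans (sym (==-refl i)) h)

  ≢⇒==-false : {i j : Fin k} → i ≢ j → (i == j) ≡ false
  ≢⇒==-false {i} {j} = dec-false (i Fin.≟ j)

≡ᵇ-true⇒≡ : ∀ {m n} → (m ≡ᵇ n) ≡ true → m ≡ n
≡ᵇ-true⇒≡ {m} {n} h = ≡ᵇ⇒≡ m n (Equivalence.from T-≡ h)

≡⇒≡ᵇ-true : ∀ {m n} → m ≡ n → (m ≡ᵇ n) ≡ true
≡⇒≡ᵇ-true {m} {n} eq = Equivalence.to T-≡ (≡⇒≡ᵇ m n eq)

≤ᵇ-true⇒≤ : ∀ {m n} → (m ≤ᵇ n) ≡ true → m ≤ n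
≤ᵇ-true⇒≤ {m} {n} h = ≤ᵇ⇒≤ m n (Equivalence.from T-≡ h)

≤⇒≤ᵇ-true : ∀ {m n} → m ≤ n → (m ≤ᵇ n) ≡ true
≤⇒≤ᵇ-true le = Equivalence.to T-≡ (≤⇒≤ᵇ le)

all-cong : ∀ {P Q : A → Bool} xs → (∀ x → P x ≡ Q x) → all P xs ≡ all Q xs
all-cong []       P≡Q = refl
all-cong (x ∷ xs) P≡Q = cong₂ _∧_ (P≡Q x) (all-cong xs P≡Q)

all-tabulate⇒ : ∀ {m} (P : A → Bool) (g : Fin m → A) → all P (tabulate g) ≡ true → ∀ i → P (g i) ≡ true
all-tabulate⇒ P g h zero    = ∧-true₁ h
all-tabulate⇒ P g h (suc i) = all-tabulate⇒ P (g ∘ suc) (∧-true₂ {P (g zero)} h) i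

all-tabulate⇐ : ∀ {m} (P : A → Bool) (g : Fin m → A) → (∀ i → P (g i) ≡ true) → all P (tabulate g) ≡ true
all-tabulate⇐ {m = zero}  P g h = refl
all-tabulate⇐ {m = suc m} P g h rewrite h zero = all-tabulate⇐ P (g ∘ suc) (h ∘ suc)

all-tabulate : ∀ {m} (P : A → Bool) (g : Fin m → A) → all P (tabulate g) ≡ all (P ∘ g) (allFin m)
all-tabulate P g = Bool-ext
  (λ h → all-tabulate⇐ (P ∘ g) id (all-tabulate⇒ P g h))
  (λ h → all-tabulate⇐ P g (all-tabulate⇒ (P ∘ g) id h))

module _ {k : ℕ} where

  infix  4 _∈ᵇ_
  infixl 6 _∖_

  _∈ᵇ_ : Fin k → List (Fin k) → Bool
  v ∈ᵇ []      = false
  v ∈ᵇ (u ∷ R) = (v == u) ∨ (v ∈ᵇ R)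

  _∖_ : List (Fin k) → Fin k → List (Fin k)
  []      ∖ v = []
  (u ∷ R) ∖ v = if u == v then R ∖ v else u ∷ R ∖ v

  NoDup : List (Fin k) → Set
  NoDup []      = ⊤
  NoDup (u ∷ R) = (u ∈ᵇ R) ≡ false × NoDup R

  ∈ᵇ-∖ : ∀ w v R → (w ∈ᵇ R ∖ v) ≡ (w ∈ᵇ R) ∧ not (w == v)
  ∈ᵇ-∖ w v []      = refl
  ∈ᵇ-∖ w v (u ∷ R) with u == v in u=v
  ... | true with refl ← ==⇒≡ {i = u} {j = v} u=v rewrite ∈ᵇ-∖ w u R = absorb (w == u) (w ∈ᵇ R)
    where
    absorb : ∀ a b → b ∧ not a ≡ (a ∨ b) ∧ not a
    absorb true  b = ∧-zeroʳ b
    absorb false b = refl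
  ... | false rewrite ∈ᵇ-∖ w v R with w == u in w=u
  ...   | true with refl ← ==⇒≡ {i = w} {j = u} w=u rewrite u=v = refl
  ...   | false = refl

  ∈ᵇ-∖⇒∈ᵇ : ∀ w v R → (w ∈ᵇ R ∖ v) ≡ true → (w ∈ᵇ R) ≡ true
  ∈ᵇ-∖⇒∈ᵇ w v R h = ∧-true₁ (trans (sym (∈ᵇ-∖ w v R)) h)

  ∖-comm : ∀ v w R → R ∖ v ∖ w ≡ R ∖ w ∖ v
  ∖-comm v w []      = refl
  ∖-comm v w (u ∷ R) with u == v in u=v | u == w in u=w
  ... | true  | true                = ∖-comm v w R
  ... | true  | false rewrite u=v   = ∖-comm v w R
  ... | false | true  rewrite u=w   = ∖-comm v w R
  ... | false | false rewrite u=v | u=w = cong (u ∷_) (∖-comm v w R)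

  length-∖-≤ : ∀ v R → length (R ∖ v) ≤ length R
  length-∖-≤ v []      = z≤n
  length-∖-≤ v (u ∷ R) with u == v
  ... | true  = m≤n⇒m≤1+n (length-∖-≤ v R)
  ... | false = s≤s (length-∖-≤ v R)

  length-∖-< : ∀ v R → (v ∈ᵇ R) ≡ true → length (R ∖ v) < length R
  length-∖-< v (u ∷ R) v∈R with u == v in u=v
  ... | true  = s≤s (length-∖-≤ v R)
  ... | false rewrite ==-sym v u | u=v = s≤s (length-∖-< v R v∈R)

  ∖-∉ : ∀ v R → (v ∈ᵇ R) ≡ false → R ∖ v ≡ R
  ∖-∉ v []      _   = refl
  ∖-∉ v (u ∷ R) v∉R with u == v in u=v
  ... | true  rewrite ==-sym v u | u=v = ⊥-elim (true≢false v∉R)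
  ... | false rewrite ==-sym v u | u=v = cong (u ∷_) (∖-∉ v R v∉R)

  NoDup-∖ : ∀ v R → NoDup R → NoDup (R ∖ v)
  NoDup-∖ v []      _          = tt
  NoDup-∖ v (u ∷ R) (u∉R , nd) with u == v
  ... | true  = NoDup-∖ v R nd
  ... | false = trans (∈ᵇ-∖ u v R) (cong (_∧ not (u == v)) u∉R) , NoDup-∖ v R nd

  length-∖ : ∀ v R → NoDup R → (v ∈ᵇ R) ≡ true → suc (length (R ∖ v)) ≡ length R
  length-∖ v (u ∷ R) (u∉R , nd) v∈R with u == v in u=v
  ... | true with refl ← ==⇒≡ {i = u} {j = v} u=v = cong (suc ∘ length) (∖-∉ u R u∉R)
  ... | false rewrite ==-sym v u | u=v = cong suc (length-∖ v R nd v∈R)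

∈ᵇ-tabulate-suc : ∀ {k m} (g : Fin m → Fin k) v → (suc v ∈ᵇ tabulate (Fin.suc ∘ g)) ≡ (v ∈ᵇ tabulate g)
∈ᵇ-tabulate-suc {m = zero}  g v = refl
∈ᵇ-tabulate-suc {m = suc m} g v = cong ((v == g zero) ∨_) (∈ᵇ-tabulate-suc (g ∘ suc) v)

zero-∉-tabulate-suc : ∀ {k m} (g : Fin m → Fin k) → (zero ∈ᵇ tabulate (Fin.suc ∘ g)) ≡ false
zero-∉-tabulate-suc {m = zero}  g = refl
zero-∉-tabulate-suc {m = suc m} g = zero-∉-tabulate-suc (g ∘ suc)

NoDup-tabulate-suc : ∀ {k m} (g : Fin m → Fin k) → NoDup (tabulate g) → NoDup (tabulate (Fin.suc ∘ g))
NoDup-tabulate-suc {m = zero}  g _          = tt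
NoDup-tabulate-suc {m = suc m} g (g₀∉ , nd) =
  trans (∈ᵇ-tabulate-suc (g ∘ suc) (g zero)) g₀∉ , NoDup-tabulate-suc (g ∘ suc) nd

NoDup-allFin : ∀ m → NoDup (allFin m)
NoDup-allFin zero    = tt
NoDup-allFin (suc m) = zero-∉-tabulate-suc {k = m} id , NoDup-tabulate-suc id (NoDup-allFin m)

∈ᵇ-allFin : ∀ {m} (v : Fin m) → (v ∈ᵇ allFin m) ≡ true
∈ᵇ-allFin zero    = refl
∈ᵇ-allFin (suc v) = trans (∈ᵇ-tabulate-suc id v) (∈ᵇ-allFin v)

⊙-distrib-∑ : ∀ b {m} (f : Fin m → ℕ) → b ⊙ sum f ≡ ∑[ i < m ] (b ⊙ f i)
⊙-distrib-∑ true      f = refl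
⊙-distrib-∑ false {m} f = sym (sum-replicate-zero m)

∑-pick : ∀ {m} (v : Fin m) (f : Fin m → ℕ) → sum f ≡ f v + ∑[ i < m ] (not (i == v) ⊙ f i)
∑-pick zero    f = refl
∑-pick (suc v) f =
  trans (cong (f zero +_) (∑-pick v (f ∘ suc))) (x+[y+z]≡y+[x+z] (f zero) (f (suc v)) _)

sumBelow : ℕ → (ℕ → ℕ) → ℕ
sumBelow a f = ∑[ i < a ] f (toℕ i)

sumBelow-cong : ∀ a {f g : ℕ → ℕ} → (∀ m → m < a → f m ≡ g m) → sumBelow a f ≡ sumBelow a g
sumBelow-cong a f≡g = sum-cong-≗ (λ i → f≡g (toℕ i) (toℕ<n i))

sumBelow-suc : ∀ a f → sumBelow (suc a) f ≡ sumBelow a f + f a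
sumBelow-suc zero    f = +-comm (f 0) 0
sumBelow-suc (suc a) f = trans (cong (f 0 +_) (sumBelow-suc a (f ∘ suc))) (sym (+-assoc (f 0) _ _))

sumBelow-extend : ∀ a M f → (∀ m → M ≤ m → f m ≡ 0) →
                  sumBelow a f ≡ sumBelow M (λ m → (m <ᵇ a) ⊙ f m)
sumBelow-extend zero    M       f f≡0 = sym (sum-replicate-zero M)
sumBelow-extend (suc a) zero    f f≡0 =
  cong₂ _+_ (f≡0 0 z≤n) (sumBelow-extend a zero (f ∘ suc) (λ m _ → f≡0 (suc m) z≤n))
sumBelow-extend (suc a) (suc M) f f≡0 =
  cong (f 0 +_) (sumBelow-extend a M (f ∘ suc) (λ m M≤m → f≡0 (suc m) (s≤s M≤m)))

∑-⊙-+-sumBelow : ∀ {m} (c : Fin m → Bool) (f : Fin m → ℕ) (g : Fin m → ℕ → ℕ) a →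
                 ∑[ v < m ] (c v ⊙ (f v + sumBelow a (g v)))
                   ≡ ∑[ v < m ] (c v ⊙ f v) + sumBelow a (λ k → ∑[ v < m ] (c v ⊙ g v k))
∑-⊙-+-sumBelow {m} c f g a = begin
  ∑[ v < m ] (c v ⊙ (f v + sumBelow a (g v)))
    ≡⟨ sum-cong-≗ (λ v → trans (⊙-distrib-+ (c v) _ _) (cong (c v ⊙ f v +_) (⊙-distrib-∑ (c v) {a} _))) ⟩
  ∑[ v < m ] (c v ⊙ f v + sumBelow a (λ k → c v ⊙ g v k))
    ≡⟨ ∑-distrib-+ {m} _ _ ⟩
  ∑[ v < m ] (c v ⊙ f v) + ∑[ v < m ] sumBelow a (λ k → c v ⊙ g v k)
    ≡⟨ cong (∑[ v < m ] (c v ⊙ f v) +_) (∑-comm {m} {a} (λ v i → c v ⊙ g v (toℕ i))) ⟩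
  ∑[ v < m ] (c v ⊙ f v) + sumBelow a (λ k → ∑[ v < m ] (c v ⊙ g v k)) ∎

sumMap : (A → ℕ) → List A → ℕ
sumMap f xs = sumℕ (map f xs)

sumMap-cong : ∀ {f g : A → ℕ} xs → (∀ x → f x ≡ g x) → sumMap f xs ≡ sumMap g xs
sumMap-cong []       f≡g = refl
sumMap-cong (x ∷ xs) f≡g = cong₂ _+_ (f≡g x) (sumMap-cong xs f≡g)

⊙-distrib-sumMap : ∀ b (f : A → ℕ) xs → b ⊙ sumMap f xs ≡ sumMap (λ x → b ⊙ f x) xs
⊙-distrib-sumMap true  f xs       = refl
⊙-distrib-sumMap false f []       = refl
⊙-distrib-sumMap false f (x ∷ xs) = ⊙-distrib-sumMap false f xs

sumMap-++ : ∀ (f : A → ℕ) xs ys → sumMap f (xs ++ ys) ≡ sumMap f xs + sumMap f ys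
sumMap-++ f xs ys = trans (cong sumℕ (map-++ f xs ys)) (sum-++ (map f xs) (map f ys))

sumMap-concatMap : ∀ (f : B → ℕ) (g : A → List B) xs →
                   sumMap f (concatMap g xs) ≡ sumMap (sumMap f ∘ g) xs
sumMap-concatMap f g []       = refl
sumMap-concatMap f g (x ∷ xs) =
  trans (sumMap-++ f (g x) (concatMap g xs)) (cong (sumMap f (g x) +_) (sumMap-concatMap f g xs))

sumMap-map : ∀ (f : B → ℕ) (g : A → B) xs → sumMap f (map g xs) ≡ sumMap (f ∘ g) xs
sumMap-map f g []       = refl
sumMap-map f g (x ∷ xs) = cong (f (g x) +_) (sumMap-map f g xs)

sumMap-∑ : ∀ {m} (f : A → Fin m → ℕ) xs →
           sumMap (λ x → ∑[ i < m ] f x i) xs ≡ ∑[ i < m ] sumMap (λ x → f x i) xs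
sumMap-∑ {m = m} f []       = sym (sum-replicate-zero m)
sumMap-∑     f (x ∷ xs) =
  trans (cong (sum (f x) +_) (sumMap-∑ f xs)) (sym (∑-distrib-+ (f x) _))

count≡sumMap : ∀ (P : A → Bool) xs → count P xs ≡ sumMap (λ x → P x ⊙ 1) xs
count≡sumMap P []       = refl
count≡sumMap P (x ∷ xs) with P x
... | true  = cong suc (count≡sumMap P xs)
... | false = count≡sumMap P xs

count-cong : ∀ {P Q : A → Bool} xs → (∀ x → P x ≡ Q x) → count P xs ≡ count Q xs
count-cong {P = P} {Q} xs P≡Q = trans (count≡sumMap P xs)
  (trans (sumMap-cong xs (λ x → cong (_⊙ 1) (P≡Q x))) (sym (count≡sumMap Q xs)))

sumMap-tabulate : ∀ {m} (f : A → ℕ) (g : Fin m → A) → sumMap f (tabulate g) ≡ ∑[ i < m ] f (g i)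
sumMap-tabulate {m = zero}  f g = refl
sumMap-tabulate {m = suc m} f g = cong (f (g zero) +_) (sumMap-tabulate f (g ∘ suc))

All-concatMap⁺ : ∀ {P : B → Set} (g : A → List B) {xs} → All (λ x → All P (g x)) xs → All P (concatMap g xs)
All-concatMap⁺ g all = concat⁺ (map⁺ all)

sumMap-allFin : ∀ {m} (f : Fin m → ℕ) → sumMap f (allFin m) ≡ sum f
sumMap-allFin f = sumMap-tabulate f id

sumMap-funs-suc : ∀ a b (H : Fin b → (Fin a → Fin b) → ℕ) →
                  sumMap (λ g → H (g zero) (g ∘ suc)) (funs (suc a) b) ≡ ∑[ y < b ] sumMap (H y) (funs a b)
sumMap-funs-suc a b H = begin
  sumMap (λ g → H (g zero) (g ∘ suc)) (funs (suc a) b)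
    ≡⟨ sumMap-concatMap _ _ (funs a b) ⟩
  sumMap (λ f → sumMap (λ g → H (g zero) (g ∘ suc)) (map (λ y → _) (allFin b))) (funs a b)
    ≡⟨ sumMap-cong (funs a b) (λ f → trans (sumMap-map _ _ (allFin b)) (sumMap-allFin {m = b} _)) ⟩
  sumMap (λ f → ∑[ y < b ] H y f) (funs a b)
    ≡⟨ sumMap-∑ (λ f y → H y f) (funs a b) ⟩
  ∑[ y < b ] sumMap (H y) (funs a b) ∎

-- Power sums

lowerAt : ∀ {N} → (Fin N → ℕ) → Fin N → ℕ → Fin N → ℕ
lowerAt α y p k = if y == k then α k ∸ p else α k

lowerAt-comm : ∀ {N} (α : Fin N → ℕ) y p y′ q k →
               lowerAt (lowerAt α y p) y′ q k ≡ lowerAt (lowerAt α y′ q) y p k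
lowerAt-comm α y p y′ q k with y == k | y′ == k
... | true  | true  = trans (∸-+-assoc (α k) p q) (trans (cong (α k ∸_) (+-comm p q)) (sym (∸-+-assoc (α k) q p)))
... | true  | false = refl
... | false | true  = refl
... | false | false = refl

isZero : ∀ {N} → (Fin N → ℕ) → Bool
isZero {N} α = all (λ k → 0 ≡ᵇ α k) (allFin N)

isZero-suc : ∀ {N} (α : Fin (suc N) → ℕ) → isZero α ≡ (0 ≡ᵇ α zero) ∧ isZero (α ∘ suc)
isZero-suc α = cong ((0 ≡ᵇ α zero) ∧_) (all-tabulate (λ k → 0 ≡ᵇ α k) suc)

partContent : ∀ {N} (λs : List ℕ) → (Fin (length λs) → Fin N) → Fin N → ℕ
partContent λs f k = sumℕ (map (λ j → if f j == k then List.lookup λs j else 0) (allFin (length λs)))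

partContent-cons : ∀ {N} p λs (g : Fin (suc (length λs)) → Fin N) k →
                   partContent (p ∷ λs) g k ≡ (if g zero == k then p else 0) + partContent λs (g ∘ suc) k
partContent-cons p λs g k = cong ((if g zero == k then p else 0) +_) (cong sumℕ
  (trans (map-tabulate suc (λ j → if g j == k then List.lookup (p ∷ λs) j else 0))
         (sym (map-tabulate id (λ j → if g (suc j) == k then List.lookup λs j else 0)))))

addAt-≡ : ∀ {N} p (y : Fin N) (c α : Fin N → ℕ) →
          all (λ k → ((if y == k then p else 0) + c k) ≡ᵇ α k) (allFin N)
            ≡ (p ≤ᵇ α y) ∧ all (λ k → c k ≡ᵇ lowerAt α y p k) (allFin N)
addAt-≡ {N} p y c α = Bool-ext to from
  where
  entry : ∀ k → p ≤ α y → (if y == k then p else 0) + c k ≡ α k ⇔ c k ≡ lowerAt α y p k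
  entry k p≤αy with y == k in y=k
  ... | true with refl ← ==⇒≡ {i = y} {j = k} y=k =
    mk⇔ (λ eq → trans (sym (m+n∸m≡n p (c y))) (cong (_∸ p) eq))
        (λ eq → trans (cong (p +_) eq) (m+[n∸m]≡n p≤αy))
  ... | false = mk⇔ id id

  to : _ ≡ true → _ ≡ true
  to h = cong₂ _∧_ (≤⇒≤ᵇ-true p≤αy) (all-tabulate⇐ _ id λ k →
           ≡⇒≡ᵇ-true (Equivalence.to (entry k p≤αy) (≡ᵇ-true⇒≡ (all-tabulate⇒ _ id h k))))
    where
    p+cy≡αy : p + c y ≡ α y
    p+cy≡αy = subst (λ b → (if b then p else 0) + c y ≡ α y) (==-refl y) (≡ᵇ-true⇒≡ (all-tabulate⇒ _ id h y))
    p≤αy : p ≤ α y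
    p≤αy = subst (p ≤_) p+cy≡αy (m≤m+n p (c y))

  from : _ ≡ true → _ ≡ true
  from h = all-tabulate⇐ _ id λ k → ≡⇒≡ᵇ-true (Equivalence.from (entry k p≤αy)
             (≡ᵇ-true⇒≡ (all-tabulate⇒ _ id (∧-true₂ {p ≤ᵇ α y} h) k)))
    where
    p≤αy : p ≤ α y
    p≤αy = ≤ᵇ-true⇒≤ (∧-true₁ h)

coeffP-cong : ∀ λs N {α β : Fin N → ℕ} → (∀ k → α k ≡ β k) → coeffP λs N α ≡ coeffP λs N β
coeffP-cong λs N α≗β =
  count-cong (funs (length λs) N) (λ f → all-cong (allFin N) (λ k → cong (partContent λs f k ≡ᵇ_) (α≗β k)))

coeffP-cons : ∀ p λs N α → coeffP (p ∷ λs) N α ≡ ∑[ y < N ] ((p ≤ᵇ α y) ⊙ coeffP λs N (lowerAt α y p))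
coeffP-cons p λs N α = begin
  coeffP (p ∷ λs) N α
    ≡⟨ count≡sumMap _ (funs (suc ℓ) N) ⟩
  sumMap (λ g → all (λ k → partContent (p ∷ λs) g k ≡ᵇ α k) (allFin N) ⊙ 1) (funs (suc ℓ) N)
    ≡⟨ sumMap-cong (funs (suc ℓ) N) (λ g → cong (_⊙ 1)
         (all-cong (allFin N) (λ k → cong (_≡ᵇ α k) (partContent-cons p λs g k)))) ⟩
  sumMap (λ g → H (g zero) (g ∘ suc)) (funs (suc ℓ) N)
    ≡⟨ sumMap-funs-suc ℓ N H ⟩
  ∑[ y < N ] sumMap (H y) (funs ℓ N)
    ≡⟨ sum-cong-≗ first-part-at ⟩
  ∑[ y < N ] ((p ≤ᵇ α y) ⊙ coeffP λs N (lowerAt α y p)) ∎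
  where
  ℓ : ℕ
  ℓ = length λs
  H : Fin N → (Fin ℓ → Fin N) → ℕ
  H y f = all (λ k → ((if y == k then p else 0) + partContent λs f k) ≡ᵇ α k) (allFin N) ⊙ 1
  first-part-at : ∀ y → sumMap (H y) (funs ℓ N) ≡ (p ≤ᵇ α y) ⊙ coeffP λs N (lowerAt α y p)
  first-part-at y = begin
    sumMap (H y) (funs ℓ N)
      ≡⟨ sumMap-cong (funs ℓ N) (λ f → trans (cong (_⊙ 1) (addAt-≡ p y (partContent λs f) α)) (∧-⊙ (p ≤ᵇ α y) _ 1)) ⟩
    sumMap (λ f → (p ≤ᵇ α y) ⊙ all (λ k → partContent λs f k ≡ᵇ lowerAt α y p k) (allFin N) ⊙ 1) (funs ℓ N)
      ≡⟨ sym (⊙-distrib-sumMap (p ≤ᵇ α y) _ (funs ℓ N)) ⟩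
    (p ≤ᵇ α y) ⊙ sumMap (λ f → all (λ k → partContent λs f k ≡ᵇ lowerAt α y p k) (allFin N) ⊙ 1) (funs ℓ N)
      ≡⟨ cong ((p ≤ᵇ α y) ⊙_) (sym (count≡sumMap _ (funs ℓ N))) ⟩
    (p ≤ᵇ α y) ⊙ coeffP λs N (lowerAt α y p) ∎

≤ᵇ-∸ : ∀ p q a → (p ≤ᵇ a) ∧ (q ≤ᵇ a ∸ p) ≡ (q + p ≤ᵇ a)
≤ᵇ-∸ p q a = Bool-ext
  (λ h → ≤⇒≤ᵇ-true (m≤o∸n⇒m+n≤o q (≤ᵇ-true⇒≤ (∧-true₁ h)) (≤ᵇ-true⇒≤ (∧-true₂ {p ≤ᵇ a} h))))
  (λ h → cong₂ _∧_ (≤⇒≤ᵇ-true (m+n≤o⇒n≤o q (≤ᵇ-true⇒≤ h)))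
                   (≤⇒≤ᵇ-true (m+n≤o⇒m≤o∸n q (≤ᵇ-true⇒≤ h))))

fits-comm : ∀ {N} (α : Fin N → ℕ) y p y′ q →
            (p ≤ᵇ α y) ∧ (q ≤ᵇ lowerAt α y p y′) ≡ (q ≤ᵇ α y′) ∧ (p ≤ᵇ lowerAt α y′ q y)
fits-comm α y p y′ q with y == y′ in y=y′
... | true with refl ← ==⇒≡ {i = y} {j = y′} y=y′ rewrite ==-refl y =
  trans (≤ᵇ-∸ p q (α y)) (trans (cong (_≤ᵇ α y) (+-comm q p)) (sym (≤ᵇ-∸ q p (α y))))
... | false rewrite ==-sym y′ y | y=y′ = ∧-comm (p ≤ᵇ α y) (q ≤ᵇ α y′)

coeffP-swap : ∀ p q λs N α → coeffP (p ∷ q ∷ λs) N α ≡ coeffP (q ∷ p ∷ λs) N α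
coeffP-swap p q λs N α = begin
  coeffP (p ∷ q ∷ λs) N α
    ≡⟨ expand p q ⟩
  ∑[ y < N ] ∑[ y′ < N ] term p q y y′
    ≡⟨ sum-cong-≗ (λ y → sum-cong-≗ (λ y′ → term-comm y y′)) ⟩
  ∑[ y < N ] ∑[ y′ < N ] term q p y′ y
    ≡⟨ ∑-comm (λ y y′ → term q p y′ y) ⟩
  ∑[ y′ < N ] ∑[ y < N ] term q p y′ y
    ≡⟨ sym (expand q p) ⟩
  coeffP (q ∷ p ∷ λs) N α ∎
  where
  term : ℕ → ℕ → Fin N → Fin N → ℕ
  term r s y y′ = (r ≤ᵇ α y) ⊙ (s ≤ᵇ lowerAt α y r y′) ⊙ coeffP λs N (lowerAt (lowerAt α y r) y′ s)

  expand : ∀ r s → coeffP (r ∷ s ∷ λs) N α ≡ ∑[ y < N ] ∑[ y′ < N ] term r s y y′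
  expand r s = trans (coeffP-cons r (s ∷ λs) N α) (sum-cong-≗ λ y →
    trans (cong ((r ≤ᵇ α y) ⊙_) (coeffP-cons s λs N (lowerAt α y r))) (⊙-distrib-∑ (r ≤ᵇ α y) {N} _))

  term-comm : ∀ y y′ → term p q y y′ ≡ term q p y′ y
  term-comm y y′ = trans (⊙-⊙-cong (p ≤ᵇ α y) (q ≤ᵇ α y′) (fits-comm α y p y′ q))
    (cong (λ z → (q ≤ᵇ α y′) ⊙ (p ≤ᵇ lowerAt α y′ q y) ⊙ z) (coeffP-cong λs N (lowerAt-comm α y p y′ q)))

coeffP-∷-cong : ∀ p {λs μs} N → (∀ α → coeffP λs N α ≡ coeffP μs N α) →
                ∀ α → coeffP (p ∷ λs) N α ≡ coeffP (p ∷ μs) N α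
coeffP-∷-cong p {λs} {μs} N λs≡μs α = trans (coeffP-cons p λs N α)
  (trans (sum-cong-≗ (λ y → cong ((p ≤ᵇ α y) ⊙_) (λs≡μs (lowerAt α y p)))) (sym (coeffP-cons p μs N α)))

coeffP-↭ : ∀ {λs μs} → λs ↭ μs → ∀ N α → coeffP λs N α ≡ coeffP μs N α
coeffP-↭ ↭-refl          N α = refl
coeffP-↭ {p ∷ λs} {p ∷ μs} (prep p λs↭μs) N = coeffP-∷-cong p {λs} {μs} N (coeffP-↭ λs↭μs N)
coeffP-↭ {p ∷ q ∷ λs} {q ∷ p ∷ μs} (swap p q λs↭μs) N α = trans (coeffP-swap p q λs N α)
  (coeffP-∷-cong q {p ∷ λs} {p ∷ μs} N (coeffP-∷-cong p {λs} {μs} N (coeffP-↭ λs↭μs N)) α)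
coeffP-↭ (↭-trans λs↭νs νs↭μs) N α = trans (coeffP-↭ λs↭νs N α) (coeffP-↭ νs↭μs N α)

-- Listings and colourings

injectsInto : ∀ {k a} → List (Fin k) → (Fin a → Fin k) → Bool
injectsInto {a = zero}  R π = true
injectsInto {a = suc a} R π = (π zero ∈ᵇ R) ∧ injectsInto (R ∖ π zero) (π ∘ suc)

injectsInto⇒ : ∀ {k a} R (π : Fin a → Fin k) → injectsInto R π ≡ true →
               (∀ i → (π i ∈ᵇ R) ≡ true) × Injective _≡_ _≡_ π
injectsInto⇒ {a = zero}  R π _ = (λ ()) , λ {}
injectsInto⇒ {k} {a = suc a} R π h = members , injective
  where
  π₀ : Fin k
  π₀ = π zero
  ih : (∀ i → (π (suc i) ∈ᵇ R ∖ π₀) ≡ true) × Injective _≡_ _≡_ (π ∘ suc)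
  ih = injectsInto⇒ (R ∖ π₀) (π ∘ suc) (∧-true₂ {π₀ ∈ᵇ R} h)

  members : ∀ i → (π i ∈ᵇ R) ≡ true
  members zero    = ∧-true₁ h
  members (suc i) = ∈ᵇ-∖⇒∈ᵇ (π (suc i)) π₀ R (proj₁ ih i)

  later≢π₀ : ∀ i → π (suc i) ≢ π₀
  later≢π₀ i eq = true≢false (begin
    true                      ≡⟨ sym (==-refl π₀) ⟩
    (π₀ == π₀)                ≡⟨ cong (_== π₀) (sym eq) ⟩
    (π (suc i) == π₀)         ≡⟨ not-true (∧-true₂ {π (suc i) ∈ᵇ R} (trans (sym (∈ᵇ-∖ _ π₀ R)) (proj₁ ih i))) ⟩
    false                     ∎)

  injective : Injective _≡_ _≡_ π
  injective {zero}  {zero}  _  = refl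
  injective {zero}  {suc j} eq = ⊥-elim (later≢π₀ j (sym eq))
  injective {suc i} {zero}  eq = ⊥-elim (later≢π₀ i eq)
  injective {suc i} {suc j} eq = cong suc (proj₂ ih eq)

injectsInto⇐ : ∀ {k a} R (π : Fin a → Fin k) → (∀ i → (π i ∈ᵇ R) ≡ true) → Injective _≡_ _≡_ π →
               injectsInto R π ≡ true
injectsInto⇐ {a = zero}  R π _       _   = refl
injectsInto⇐ {a = suc a} R π members inj rewrite members zero = injectsInto⇐ (R ∖ π zero) (π ∘ suc)
  (λ i → trans (∈ᵇ-∖ (π (suc i)) (π zero) R)
               (cong₂ (λ p q → p ∧ not q) (members (suc i)) (≢⇒==-false (λ eq → Finₚ.0≢1+n (sym (inj eq))))))
  (λ eq → Finₚ.suc-injective (inj eq))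

injB≡injectsInto : ∀ {k} (π : Fin k → Fin k) → injB π ≡ injectsInto (allFin k) π
injB≡injectsInto {k} π = Bool-ext
  (λ h → injectsInto⇐ (allFin k) π (λ i → ∈ᵇ-allFin (π i)) λ {i} {j} eq →
     ==⇒≡ (subst (λ b → not b ∨ (i == j) ≡ true) (trans (cong (_== π j) eq) (==-refl (π j)))
                 (all-tabulate⇒ _ id (all-tabulate⇒ _ id h i) j)))
  (λ h → all-tabulate⇐ _ id λ i → all-tabulate⇐ _ id λ j → pair i j (proj₂ (injectsInto⇒ (allFin k) π h)))
  where
  pair : ∀ i j → Injective _≡_ _≡_ π → not (π i == π j) ∨ (i == j) ≡ true
  pair i j inj with π i == π j in eq
  ... | true rewrite inj (==⇒≡ {i = π i} {j = π j} eq) = ==-refl j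
  ... | false = refl

contentIs : ∀ {N a} → (Fin a → Fin N) → (Fin N → ℕ) → Bool
contentIs {a = zero}  s α = isZero α
contentIs {a = suc a} s α = (1 ≤ᵇ α (s zero)) ∧ contentIs (s ∘ suc) (lowerAt α (s zero) 1)

hasContent≡contentIs : ∀ {N a} (s : Fin a → Fin N) α → hasContent s α ≡ contentIs s α
hasContent≡contentIs {a = zero}      s α = refl
hasContent≡contentIs {N} {a = suc a} s α = begin
  hasContent s α
    ≡⟨ all-cong (allFin N) (λ k → cong (_≡ᵇ α k) (trans (if-suc (s zero == k) _)
         (cong ((if s zero == k then 1 else 0) +_) (count-tabulate (λ j → s j == k) suc)))) ⟩
  all (λ k → ((if s zero == k then 1 else 0) + count (λ j → s (suc j) == k) (allFin a)) ≡ᵇ α k) (allFin N)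
    ≡⟨ addAt-≡ 1 (s zero) (λ k → count (λ j → s (suc j) == k) (allFin a)) α ⟩
  (1 ≤ᵇ α (s zero)) ∧ hasContent (s ∘ suc) (lowerAt α (s zero) 1)
    ≡⟨ cong ((1 ≤ᵇ α (s zero)) ∧_) (hasContent≡contentIs (s ∘ suc) (lowerAt α (s zero) 1)) ⟩
  contentIs s α ∎
  where
  if-suc : ∀ b r → (if b then suc r else r) ≡ (if b then 1 else 0) + r
  if-suc true  r = refl
  if-suc false r = refl
  count-tabulate : ∀ {m} (P : Fin (suc m) → Bool) (g : Fin m → Fin (suc m)) → count P (tabulate g) ≡ count (P ∘ g) (allFin m)
  count-tabulate {m} P g = trans (count≡sumMap P (tabulate g)) (trans (sumMap-tabulate (λ x → P x ⊙ 1) g)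
    (sym (trans (count≡sumMap (P ∘ g) (allFin m)) (sumMap-allFin (λ i → P (g i) ⊙ 1)))))

-- Runs, and the recurrence for U at a source

module Expansion {n : ℕ} (X : Digraph n) where

  V : Set
  V = Fin n

  edge : V → V → Bool
  edge u v = does (edge? X u v)

  mayFollow : Maybe V → V → Bool
  mayFollow nothing  v = true
  mayFollow (just u) v = not (edge u v)

  admissible : List V → List V → Maybe V → V → Bool
  admissible R F x v = (v ∈ᵇ R) ∧ not (v ∈ᵇ F) ∧ mayFollow x v

  -- Sum of G (R ∖ {v₁,…,vₐ}) over the runs v₁ ⋯ vₐ in R that avoid F and may follow x.
  sumRuns : List V → List V → Maybe V → ℕ → (List V → ℕ) → ℕ
  sumRuns R F x zero    G = G R
  sumRuns R F x (suc a) G = ∑[ v < n ] (admissible R F x v ⊙ sumRuns (R ∖ v) F (just v) a G)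

  IsSource : List V → V → Set
  IsSource R v₀ = ∀ u → (u ∈ᵇ R) ≡ true → (u == v₀) ≡ false → mayFollow (just u) v₀ ≡ true

  sumRuns-cong : ∀ R F x a {G H : List V → ℕ} → (∀ R′ → G R′ ≡ H R′) → sumRuns R F x a G ≡ sumRuns R F x a H
  sumRuns-cong R F x zero    G≗H = G≗H R
  sumRuns-cong R F x (suc a) G≗H =
    sum-cong-≗ (λ v → cong (admissible R F x v ⊙_) (sumRuns-cong (R ∖ v) F (just v) a G≗H))

  sumRuns-cong-inv : ∀ (I : ℕ → List V → Set) F →
    (∀ a R v → I (suc a) R → (v ∈ᵇ R) ≡ true → (v ∈ᵇ F) ≡ false → I a (R ∖ v)) →
    ∀ R x a {G H : List V → ℕ} → I a R → (∀ R′ → I 0 R′ → G R′ ≡ H R′) → sumRuns R F x a G ≡ sumRuns R F x a H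
  sumRuns-cong-inv I F step R x zero    inv G≗H = G≗H R inv
  sumRuns-cong-inv I F step R x (suc a) inv G≗H = sum-cong-≗ λ v → ⊙-cong-true (admissible R F x v) λ adm →
    sumRuns-cong-inv I F step (R ∖ v) (just v) a
      (step a R v inv (∧-true₁ adm) (not-true (∧-true₁ (∧-true₂ {v ∈ᵇ R} adm)))) G≗H

  sumRuns-zero : ∀ R F x a → sumRuns R F x a (λ _ → 0) ≡ 0
  sumRuns-zero R F x zero    = refl
  sumRuns-zero R F x (suc a) = trans
    (sum-cong-≗ (λ v → trans (cong (admissible R F x v ⊙_) (sumRuns-zero (R ∖ v) F (just v) a)) (⊙-zeroʳ _)))
    (sum-replicate-zero n)

  sumRuns-+ : ∀ R F x a (G H : List V → ℕ) →
              sumRuns R F x a (λ R′ → G R′ + H R′) ≡ sumRuns R F x a G + sumRuns R F x a H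
  sumRuns-+ R F x zero    G H = refl
  sumRuns-+ R F x (suc a) G H = trans
    (sum-cong-≗ (λ v → trans (cong (admissible R F x v ⊙_) (sumRuns-+ (R ∖ v) F (just v) a G H))
                             (⊙-distrib-+ (admissible R F x v) _ _)))
    (∑-distrib-+ {n} _ _)

  sumRuns-⊙ : ∀ R F x a b (G : List V → ℕ) → sumRuns R F x a (λ R′ → b ⊙ G R′) ≡ b ⊙ sumRuns R F x a G
  sumRuns-⊙ R F x a true  G = refl
  sumRuns-⊙ R F x a false G = sumRuns-zero R F x a

  sumRuns-∑ : ∀ R F x a {m} (G : Fin m → List V → ℕ) →
              sumRuns R F x a (λ R′ → ∑[ k < m ] G k R′) ≡ ∑[ k < m ] sumRuns R F x a (G k)
  sumRuns-∑ R F x zero    G = refl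
  sumRuns-∑ R F x (suc a) {m} G = trans
    (sum-cong-≗ (λ v → trans (cong (admissible R F x v ⊙_) (sumRuns-∑ (R ∖ v) F (just v) a G))
                             (⊙-distrib-∑ (admissible R F x v) {m} _)))
    (∑-comm (λ v k → admissible R F x v ⊙ sumRuns (R ∖ v) F (just v) a (G k)))

  sumRuns-sumBelow : ∀ R F x a M (G : ℕ → List V → ℕ) →
                     sumRuns R F x a (λ R′ → sumBelow M (λ m → G m R′)) ≡ sumBelow M (λ m → sumRuns R F x a (G m))
  sumRuns-sumBelow R F x a M G = sumRuns-∑ R F x a {M} (G ∘ toℕ)

  sumRuns-vanish : ∀ R F x a G → length R < a → sumRuns R F x a G ≡ 0
  sumRuns-vanish R F x (suc a) G |R|<a = trans
    (sum-cong-≗ (λ v → trans (⊙-cong-true (admissible R F x v) (λ adm →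
       sumRuns-vanish (R ∖ v) F (just v) a G (≤-trans (length-∖-< v R (∧-true₁ adm)) (≤-pred |R|<a))))
       (⊙-zeroʳ _)))
    (sum-replicate-zero n)

  admissible-∖ : ∀ R F x v w → admissible (R ∖ v) F x w ≡ admissible R (v ∷ F) x w
  admissible-∖ R F x v w =
    trans (cong (_∧ not (w ∈ᵇ F) ∧ mayFollow x w) (∈ᵇ-∖ w v R)) (reassoc (w ∈ᵇ R) (w == v) (w ∈ᵇ F) _)
    where
    reassoc : ∀ a b c d → (a ∧ not b) ∧ not c ∧ d ≡ a ∧ not (b ∨ c) ∧ d
    reassoc false b     c d = refl
    reassoc true  true  c d = refl
    reassoc true  false c d = refl

  admissible-∷ : ∀ R F x v₀ v → not (v == v₀) ∧ admissible R F x v ≡ admissible R (v₀ ∷ F) x v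
  admissible-∷ R F x v₀ v = shuffle (v == v₀) (v ∈ᵇ R) (v ∈ᵇ F) (mayFollow x v)
    where
    shuffle : ∀ e r f o → not e ∧ (r ∧ not f ∧ o) ≡ r ∧ not (e ∨ f) ∧ o
    shuffle true  true  f o = refl
    shuffle true  false f o = refl
    shuffle false r     f o = refl

  sumRuns-forbid : ∀ R v F x a (H : List V → ℕ) →
                   sumRuns R (v ∷ F) x a (λ R′ → H (R′ ∖ v)) ≡ sumRuns (R ∖ v) F x a H
  sumRuns-forbid R v F x zero    H = refl
  sumRuns-forbid R v F x (suc a) H = sum-cong-≗ λ w → cong₂ _⊙_
    (sym (admissible-∖ R F x v w))
    (trans (sumRuns-forbid (R ∖ w) v F (just w) a H) (cong (λ R″ → sumRuns R″ F (just w) a H) (∖-comm w v R)))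

  admissible-pick-comm : ∀ R F y (c : V → Bool) v w →
    admissible R F y w ∧ ((v ∈ᵇ R ∖ w) ∧ c v) ≡ ((v ∈ᵇ R) ∧ c v) ∧ admissible (R ∖ v) F y w
  admissible-pick-comm R F y c v w rewrite ∈ᵇ-∖ v w R | ∈ᵇ-∖ w v R | ==-sym v w =
    ∧-shuffle (w ∈ᵇ R) _ (v ∈ᵇ R) (not (w == v)) (c v)
    where
    ∧-shuffle : ∀ a b c d e → (a ∧ b) ∧ ((c ∧ d) ∧ e) ≡ (c ∧ e) ∧ ((a ∧ d) ∧ b)
    ∧-shuffle a b c d e =
      prove 5 ((a′ ⊕ b′) ⊕ ((c′ ⊕ d′) ⊕ e′)) ((c′ ⊕ e′) ⊕ ((a′ ⊕ d′) ⊕ b′)) (a ∷ b ∷ c ∷ d ∷ e ∷ [])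
      where
      open CMSolver ∧-commutativeMonoid
      a′ b′ c′ d′ e′ : Expr 5
      a′ = var 0F; b′ = var 1F; c′ = var 2F; d′ = var 3F; e′ = var 4F

  sumRuns-pick : ∀ R F y b (c : V → Bool) (K : V → List V → ℕ) →
    sumRuns R F y b (λ R′ → ∑[ v < n ] (((v ∈ᵇ R′) ∧ c v) ⊙ K v (R′ ∖ v)))
      ≡ ∑[ v < n ] (((v ∈ᵇ R) ∧ c v) ⊙ sumRuns (R ∖ v) F y b (K v))
  sumRuns-pick R F y zero    c K = refl
  sumRuns-pick R F y (suc b) c K = begin
    ∑[ w < n ] (admissible R F y w ⊙ sumRuns (R ∖ w) F (just w) b (λ R′ → ∑[ v < n ] (((v ∈ᵇ R′) ∧ c v) ⊙ K v (R′ ∖ v))))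
      ≡⟨ sum-cong-≗ (λ w → trans (cong (admissible R F y w ⊙_) (sumRuns-pick (R ∖ w) F (just w) b c K))
                                 (⊙-distrib-∑ (admissible R F y w) {n} _)) ⟩
    ∑[ w < n ] ∑[ v < n ] term w v
      ≡⟨ ∑-comm term ⟩
    ∑[ v < n ] ∑[ w < n ] term w v
      ≡⟨ sum-cong-≗ (λ v → trans (sum-cong-≗ (term-comm v)) (sym (⊙-distrib-∑ ((v ∈ᵇ R) ∧ c v) {n} _))) ⟩
    ∑[ v < n ] (((v ∈ᵇ R) ∧ c v) ⊙ ∑[ w < n ] (admissible (R ∖ v) F y w ⊙ sumRuns (R ∖ v ∖ w) F (just w) b (K v))) ∎
    where
    term : V → V → ℕ
    term w v = admissible R F y w ⊙ ((v ∈ᵇ R ∖ w) ∧ c v) ⊙ sumRuns (R ∖ w ∖ v) F (just w) b (K v)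
    term-comm : ∀ v w → term w v ≡ ((v ∈ᵇ R) ∧ c v) ⊙ admissible (R ∖ v) F y w ⊙ sumRuns (R ∖ v ∖ w) F (just w) b (K v)
    term-comm v w = trans (⊙-⊙-cong (admissible R F y w) ((v ∈ᵇ R) ∧ c v) (admissible-pick-comm R F y c v w))
      (cong (λ R″ → ((v ∈ᵇ R) ∧ c v) ⊙ admissible (R ∖ v) F y w ⊙ sumRuns R″ F (just w) b (K v)) (∖-comm w v R))

  sumRuns-comm : ∀ R F x a F′ y b (H : List V → ℕ) →
                 sumRuns R F x a (λ R′ → sumRuns R′ F′ y b H) ≡ sumRuns R F′ y b (λ R′ → sumRuns R′ F x a H)
  sumRuns-comm R F x zero    F′ y b H = refl
  sumRuns-comm R F x (suc a) F′ y b H = begin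
    ∑[ v < n ] (admissible R F x v ⊙ sumRuns (R ∖ v) F (just v) a (λ R′ → sumRuns R′ F′ y b H))
      ≡⟨ sum-cong-≗ (λ v → cong (admissible R F x v ⊙_) (sumRuns-comm (R ∖ v) F (just v) a F′ y b H)) ⟩
    ∑[ v < n ] (admissible R F x v ⊙ sumRuns (R ∖ v) F′ y b (λ R′ → sumRuns R′ F (just v) a H))
      ≡⟨ sym (sumRuns-pick R F′ y b (λ v → not (v ∈ᵇ F) ∧ mayFollow x v) (λ v R″ → sumRuns R″ F (just v) a H)) ⟩
    sumRuns R F′ y b (λ R′ → sumRuns R′ F x (suc a) H) ∎

  IsSource-∖ : ∀ {R v₀} v → IsSource R v₀ → IsSource (R ∖ v) v₀
  IsSource-∖ {R} v src u u∈R∖v = src u (∈ᵇ-∖⇒∈ᵇ u v R u∈R∖v)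

  -- A run either avoids the source v₀, or contains it followed by m further vertices;
  -- whatever precedes v₀ in the run has no edge into it.
  sumRuns-split : ∀ v₀ R F x a G → (v₀ ∈ᵇ R) ≡ true → (v₀ ∈ᵇ F) ≡ false → IsSource R v₀ → mayFollow x v₀ ≡ true →
    sumRuns R F x a G ≡ sumRuns R (v₀ ∷ F) x a G
      + sumBelow a (λ m → sumRuns R (v₀ ∷ F) x (a ∸ suc m) (λ R′ → sumRuns (R′ ∖ v₀) F (just v₀) m G))
  sumRuns-split v₀ R F x zero    G _    _    _   _    = sym (+-identityʳ (G R))
  sumRuns-split v₀ R F x (suc a) G v₀∈R v₀∉F src x-v₀ = begin
    ∑[ v < n ] (admissible R F x v ⊙ rest v)
      ≡⟨ ∑-pick v₀ _ ⟩
    admissible R F x v₀ ⊙ rest v₀ + ∑[ v < n ] (not (v == v₀) ⊙ admissible R F x v ⊙ rest v)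
      ≡⟨ cong₂ _+_ (cong (_⊙ rest v₀) admissible-v₀) (sum-cong-≗ first-not-v₀) ⟩
    P + ∑[ v < n ] (c v ⊙ (avoid v + sumBelow a (through v)))
      ≡⟨ cong (P +_) (∑-⊙-+-sumBelow c avoid through a) ⟩
    P + (∑[ v < n ] (c v ⊙ avoid v) + sumBelow a (λ m → ∑[ v < n ] (c v ⊙ through v m)))
      ≡⟨ x+[y+z]≡y+[z+x] P (∑[ v < n ] (c v ⊙ avoid v)) _ ⟩
    ∑[ v < n ] (c v ⊙ avoid v) + (sumBelow a (λ m → ∑[ v < n ] (c v ⊙ through v m)) + P)
      ≡⟨ cong (∑[ v < n ] (c v ⊙ avoid v) +_) (sym v₀-at-position) ⟩
    ∑[ v < n ] (c v ⊙ avoid v) + sumBelow (suc a) after-v₀ ∎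
    where
    rest : V → ℕ
    rest v = sumRuns (R ∖ v) F (just v) a G
    P : ℕ
    P = rest v₀
    c : V → Bool
    c = admissible R (v₀ ∷ F) x
    avoid : V → ℕ
    avoid v = sumRuns (R ∖ v) (v₀ ∷ F) (just v) a G
    K : ℕ → List V → ℕ
    K m R′ = sumRuns (R′ ∖ v₀) F (just v₀) m G
    through : V → ℕ → ℕ
    through v m = sumRuns (R ∖ v) (v₀ ∷ F) (just v) (a ∸ suc m) (K m)
    after-v₀ : ℕ → ℕ
    after-v₀ m = sumRuns R (v₀ ∷ F) x (suc a ∸ suc m) (K m)

    admissible-v₀ : admissible R F x v₀ ≡ true
    admissible-v₀ rewrite v₀∈R | v₀∉F | x-v₀ = refl

    first-not-v₀ : ∀ v → not (v == v₀) ⊙ admissible R F x v ⊙ rest v ≡ c v ⊙ (avoid v + sumBelow a (through v))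
    first-not-v₀ v = trans (⊙-⊙-cong (not (v == v₀)) (c v) (trans (admissible-∷ R F x v₀ v) (sym (∧-identityʳ _))))
      (⊙-cong-true (c v) λ cv →
        let v∈R  = ∧-true₁ cv
            v≠v₀ = ∨-conicalˡ (v == v₀) (v ∈ᵇ F) (not-true (∧-true₁ (∧-true₂ {v ∈ᵇ R} cv)))
            v₀∈R∖v = trans (∈ᵇ-∖ v₀ v R) (cong₂ (λ p q → p ∧ not q) v₀∈R (trans (==-sym v₀ v) v≠v₀))
        in sumRuns-split v₀ (R ∖ v) F (just v) a G v₀∈R∖v v₀∉F (IsSource-∖ {R} v src) (src v v∈R v≠v₀))

    v₀-at-position : sumBelow (suc a) after-v₀ ≡ sumBelow a (λ m → ∑[ v < n ] (c v ⊙ through v m)) + P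
    v₀-at-position = trans (sumBelow-suc a after-v₀) (cong₂ _+_ (sumBelow-cong a before-end) at-end)
      where
      before-end : ∀ m → m < a → after-v₀ m ≡ ∑[ v < n ] (c v ⊙ through v m)
      before-end m m<a rewrite +-∸-assoc 1 m<a = refl
      at-end : after-v₀ a ≡ P
      at-end rewrite n∸n≡0 a = refl

  -- [x^α] of U for the digraph induced on R: listings of R cut into N consecutive runs of lengths α.
  coeffUOn : List V → (N : ℕ) → (Fin N → ℕ) → ℕ
  coeffUOn R zero    α = List.null R ⊙ 1
  coeffUOn R (suc N) α = sumRuns R [] nothing (α zero) (λ R′ → coeffUOn R′ N (α ∘ suc))

  -- A colouring of a listing is compatible when it is weakly increasing and strictly increasing
  -- along edges; st is the previously placed vertex with its colour.
  colourOK : ∀ {N} → Maybe (V × Fin N) → V → Fin N → Bool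
  colourOK nothing        v c = true
  colourOK (just (u , d)) v c = (toℕ d ≤ᵇ toℕ c) ∧ (not (edge u v) ∨ (toℕ d <ᵇ toℕ c))

  -- Pairs (listing of a distinct vertices of R, compatible colouring with content α).
  colouredListings : (N : ℕ) → ℕ → List V → Maybe (V × Fin N) → (Fin N → ℕ) → ℕ
  colouredListings N zero    R st α = isZero α ⊙ 1
  colouredListings N (suc a) R st α = ∑[ v < n ] ((v ∈ᵇ R) ⊙ ∑[ c < N ]
    ((colourOK st v c ∧ (1 ≤ᵇ α c)) ⊙ colouredListings N a (R ∖ v) (just (v , c)) (lowerAt α c 1)))

  colouredListings-colour0-unreachable : ∀ N a R v c (β : Fin (suc N) → ℕ) → β zero ≢ 0 →
                                         colouredListings (suc N) a R (just (v , suc c)) β ≡ 0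
  colouredListings-colour0-unreachable N zero R v c β β₀≢0 with β zero
  ... | zero  = ⊥-elim (β₀≢0 refl)
  ... | suc _ = refl
  -- The colour-0 terms vanish by computation: colour 0 cannot follow colour suc c.
  colouredListings-colour0-unreachable N (suc a) R v c β β₀≢0 = trans
    (sum-cong-≗ λ w → trans (cong ((w ∈ᵇ R) ⊙_) (trans (sum-cong-≗ {N} λ d →
       trans (cong ((colourOK (just (v , suc c)) w (suc d) ∧ (1 ≤ᵇ β (suc d))) ⊙_)
                   (colouredListings-colour0-unreachable N a (R ∖ w) w d (lowerAt β (suc d) 1) β₀≢0))
             (⊙-zeroʳ _)) (sum-replicate-zero N)))
       (⊙-zeroʳ _))
    (sum-replicate-zero n)

  colouredListings-shift : ∀ N a R v c (β : Fin (suc N) → ℕ) → β zero ≡ 0 →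
    colouredListings (suc N) a R (just (v , suc c)) β ≡ colouredListings N a R (just (v , c)) (β ∘ suc)
  colouredListings-shift N zero    R v c β β₀≡0 rewrite isZero-suc β | β₀≡0 = refl
  colouredListings-shift N (suc a) R v c β β₀≡0 = sum-cong-≗ λ w → cong ((w ∈ᵇ R) ⊙_) (sum-cong-≗ λ d →
    cong₂ _⊙_ (cong (λ b → (b ∧ (not (edge v w) ∨ (toℕ c <ᵇ toℕ d))) ∧ (1 ≤ᵇ β (suc d))) (<ᵇ-suc (toℕ c) (toℕ d)))
              (colouredListings-shift N a (R ∖ w) w d (lowerAt β (suc d) 1) β₀≡0))
    where
    <ᵇ-suc : ∀ m n → (m <ᵇ suc n) ≡ (m ≤ᵇ n)
    <ᵇ-suc zero    n = refl
    <ᵇ-suc (suc m) n = refl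

  atColour0 : ∀ {N} → Maybe V → Maybe (V × Fin (suc N))
  atColour0 nothing  = nothing
  atColour0 (just u) = just (u , zero)

  colourOK-atColour0-zero : ∀ {N} st v → colourOK (atColour0 {N} st) v zero ≡ mayFollow st v
  colourOK-atColour0-zero nothing  v = refl
  colourOK-atColour0-zero (just u) v = ∨-identityʳ (not (edge u v))

  colourOK-atColour0-suc : ∀ {N} st v (c : Fin N) → colourOK (atColour0 st) v (suc c) ≡ true
  colourOK-atColour0-suc nothing  v c = refl
  colourOK-atColour0-suc (just u) v c = ∨-zeroʳ (not (edge u v))

  colour0-unused : ∀ N a R st (α : Fin (suc N) → ℕ) → α zero ≡ 0 →
                   colouredListings (suc N) a R (atColour0 st) α ≡ colouredListings N a R nothing (α ∘ suc)
  colour0-unused N zero    R st α α₀≡0 rewrite isZero-suc α | α₀≡0 = refl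
  colour0-unused N (suc a) R st α α₀≡0 = sum-cong-≗ λ v → cong ((v ∈ᵇ R) ⊙_) (cong₂ _+_
    (cong (_⊙ colouredListings (suc N) a (R ∖ v) (just (v , zero)) (lowerAt α zero 1))
          (trans (cong (λ k → colourOK (atColour0 st) v zero ∧ (1 ≤ᵇ k)) α₀≡0) (∧-zeroʳ _)))
    (sum-cong-≗ λ c → cong₂ _⊙_ (cong (_∧ (1 ≤ᵇ α (suc c))) (colourOK-atColour0-suc st v c))
                                (colouredListings-shift N a (R ∖ v) v c (lowerAt α (suc c) 1) α₀≡0)))

  -- The vertices of colour 0 come first and form a run.
  colouredListings-colour0 : ∀ N a R st (α : Fin (suc N) → ℕ) → NoDup R → a ≡ length R →
    colouredListings (suc N) a R (atColour0 st) α
      ≡ sumRuns R [] st (α zero) (λ R′ → colouredListings N (a ∸ α zero) R′ nothing (α ∘ suc))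

  colour0-used : ∀ N a R st (α : Fin (suc N) → ℕ) b → NoDup R → a ≡ length R → α zero ≡ suc b →
    colouredListings (suc N) a R (atColour0 st) α
      ≡ sumRuns R [] st (suc b) (λ R′ → colouredListings N (a ∸ suc b) R′ nothing (α ∘ suc))

  colouredListings-colour0 N a R st α nd a≡|R| with α zero in α₀
  ... | zero  = colour0-unused N a R st α α₀
  ... | suc b = colour0-used N a R st α b nd a≡|R| α₀

  colour0-used N zero [] st α b _ _ α₀ rewrite isZero-suc α | α₀ =
    sym (sumRuns-vanish [] [] st (suc b) (λ R′ → colouredListings N 0 R′ nothing (α ∘ suc)) (s≤s z≤n))
  colour0-used N (suc a) R st α b nd a≡|R| α₀ = sum-cong-≗ λ v →
    trans (⊙-cong-true (v ∈ᵇ R) (λ v∈R → trans (cong₂ _+_ (first-vertex v v∈R) (others-vanish v)) (+-identityʳ _)))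
          (sym (∧-⊙ (v ∈ᵇ R) _ _))
    where
    rest : ℕ → List V → ℕ
    rest k R′ = colouredListings N (a ∸ k) R′ nothing (α ∘ suc)

    first-vertex : ∀ v → (v ∈ᵇ R) ≡ true →
      (colourOK (atColour0 st) v zero ∧ (1 ≤ᵇ α zero))
        ⊙ colouredListings (suc N) a (R ∖ v) (atColour0 (just v)) (lowerAt α zero 1)
        ≡ mayFollow st v ⊙ sumRuns (R ∖ v) [] (just v) b (rest b)
    first-vertex v v∈R = begin
      (colourOK (atColour0 st) v zero ∧ (1 ≤ᵇ α zero))
        ⊙ colouredListings (suc N) a (R ∖ v) (atColour0 (just v)) (lowerAt α zero 1)
        ≡⟨ cong₂ _⊙_ (cong₂ _∧_ (colourOK-atColour0-zero st v) (cong (1 ≤ᵇ_) α₀))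
                     (colouredListings-colour0 N a (R ∖ v) (just v) _
                        (NoDup-∖ v R nd) (suc-injective (trans a≡|R| (sym (length-∖ v R nd v∈R))))) ⟩
      (mayFollow st v ∧ true) ⊙ sumRuns (R ∖ v) [] (just v) (α zero ∸ 1) (rest (α zero ∸ 1))
        ≡⟨ cong₂ _⊙_ (∧-identityʳ _) (cong (λ k → sumRuns (R ∖ v) [] (just v) (k ∸ 1) (rest (k ∸ 1))) α₀) ⟩
      mayFollow st v ⊙ sumRuns (R ∖ v) [] (just v) b (rest b) ∎

    others-vanish : ∀ v → ∑[ c < N ] ((colourOK (atColour0 st) v (suc c) ∧ (1 ≤ᵇ α (suc c)))
                            ⊙ colouredListings (suc N) a (R ∖ v) (just (v , suc c)) (lowerAt α (suc c) 1)) ≡ 0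
    others-vanish v = trans (sum-cong-≗ λ c → trans (cong (_ ⊙_)
        (colouredListings-colour0-unreachable N a (R ∖ v) v c (lowerAt α (suc c) 1) (λ eq → 0≢1+n (trans (sym eq) α₀))))
        (⊙-zeroʳ _))
      (sum-replicate-zero N)

  colouredListings≡coeffUOn : ∀ N R (α : Fin N → ℕ) → NoDup R → colouredListings N (length R) R nothing α ≡ coeffUOn R N α
  colouredListings≡coeffUOn zero    []      α _  = refl
  colouredListings≡coeffUOn zero    (u ∷ R) α _  = trans (sum-cong-≗ (λ v → ⊙-zeroʳ (v ∈ᵇ u ∷ R))) (sum-replicate-zero n)
  colouredListings≡coeffUOn (suc N) R       α nd = begin
    colouredListings (suc N) (length R) R nothing α
      ≡⟨ colouredListings-colour0 N (length R) R nothing α nd refl ⟩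
    sumRuns R [] nothing (α zero) (λ R′ → colouredListings N (length R ∸ α zero) R′ nothing (α ∘ suc))
      ≡⟨ sumRuns-cong-inv Remaining [] remove R nothing (α zero) (nd , refl) (λ R′ (nd′ , |R′|) →
           trans (cong (λ k → colouredListings N k R′ nothing (α ∘ suc))
                       (trans (cong (_∸ α zero) (sym |R′|)) (m+n∸m≡n (α zero) (length R′))))
                 (colouredListings≡coeffUOn N R′ (α ∘ suc) nd′)) ⟩
    sumRuns R [] nothing (α zero) (λ R′ → coeffUOn R′ N (α ∘ suc)) ∎
    where
    Remaining : ℕ → List V → Set
    Remaining k R′ = NoDup R′ × α zero + length R′ ≡ k + length R

    remove : ∀ k R′ v → Remaining (suc k) R′ → (v ∈ᵇ R′) ≡ true → (v ∈ᵇ []) ≡ false → Remaining k (R′ ∖ v)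
    remove k R′ v (nd′ , |R′|) v∈R′ _ = NoDup-∖ v R′ nd′ , suc-injective
      (trans (sym (+-suc (α zero) _)) (trans (cong (α zero +_) (length-∖ v R′ nd′ v∈R′)) |R′|))

  compatibleAfter : ∀ {N a} → Maybe (V × Fin N) → (Fin a → V) → (Fin a → Fin N) → Bool
  compatibleAfter {a = zero}  st π s = true
  compatibleAfter {a = suc a} st π s =
    colourOK st (π zero) (s zero) ∧ compatibleAfter (just (π zero , s zero)) (π ∘ suc) (s ∘ suc)

  countColourings : ∀ N {a} → Maybe (V × Fin N) → (Fin a → V) → (Fin N → ℕ) → ℕ
  countColourings N {a} st π α = count (λ s → compatibleAfter st π s ∧ contentIs s α) (funs a N)

  countColouredListings : (N a : ℕ) → List V → Maybe (V × Fin N) → (Fin N → ℕ) → ℕ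
  countColouredListings N a R st α = sumMap (λ π → injectsInto R π ⊙ countColourings N st π α) (funs a n)

  countColourings-suc : ∀ N {a} st (π : Fin (suc a) → V) α →
    countColourings N st π α
      ≡ ∑[ c < N ] ((colourOK st (π zero) c ∧ (1 ≤ᵇ α c)) ⊙ countColourings N (just (π zero , c)) (π ∘ suc) (lowerAt α c 1))
  countColourings-suc N {a} st π α = begin
    countColourings N st π α
      ≡⟨ count≡sumMap _ (funs (suc a) N) ⟩
    sumMap (λ s → H (s zero) (s ∘ suc)) (funs (suc a) N)
      ≡⟨ sumMap-funs-suc a N H ⟩
    ∑[ c < N ] sumMap (H c) (funs a N)
      ≡⟨ sum-cong-≗ first-colour ⟩
    ∑[ c < N ] ((colourOK st (π zero) c ∧ (1 ≤ᵇ α c)) ⊙ countColourings N (just (π zero , c)) (π ∘ suc) (lowerAt α c 1)) ∎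
    where
    K : Fin N → Bool
    K c = colourOK st (π zero) c ∧ (1 ≤ᵇ α c)
    rest : Fin N → (Fin a → Fin N) → Bool
    rest c s = compatibleAfter (just (π zero , c)) (π ∘ suc) s ∧ contentIs s (lowerAt α c 1)
    H : Fin N → (Fin a → Fin N) → ℕ
    H c s = ((colourOK st (π zero) c ∧ compatibleAfter (just (π zero , c)) (π ∘ suc) s)
             ∧ ((1 ≤ᵇ α c) ∧ contentIs s (lowerAt α c 1))) ⊙ 1
    first-colour : ∀ c → sumMap (H c) (funs a N) ≡ K c ⊙ count (rest c) (funs a N)
    first-colour c = begin
      sumMap (H c) (funs a N)
        ≡⟨ sumMap-cong (funs a N) (λ s → trans (cong (_⊙ 1) (∧-interchange (colourOK st (π zero) c) _ (1 ≤ᵇ α c) _))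
                                               (∧-⊙ (K c) _ 1)) ⟩
      sumMap (λ s → K c ⊙ rest c s ⊙ 1) (funs a N)
        ≡⟨ sym (⊙-distrib-sumMap (K c) _ (funs a N)) ⟩
      K c ⊙ sumMap (λ s → rest c s ⊙ 1) (funs a N)
        ≡⟨ cong (K c ⊙_) (sym (count≡sumMap (rest c) (funs a N))) ⟩
      K c ⊙ count (rest c) (funs a N) ∎

  countColouredListings≡colouredListings : ∀ N a R st α → countColouredListings N a R st α ≡ colouredListings N a R st α
  countColouredListings≡colouredListings N zero    R st α = +-identityʳ _
  countColouredListings≡colouredListings N (suc a) R st α = begin
    sumMap (λ π → injectsInto R π ⊙ countColourings N st π α) (funs (suc a) n)
      ≡⟨ sumMap-cong (funs (suc a) n) (λ π → cong (injectsInto R π ⊙_) (countColourings-suc N st π α)) ⟩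
    sumMap (λ π → H (π zero) (π ∘ suc)) (funs (suc a) n)
      ≡⟨ sumMap-funs-suc a n H ⟩
    ∑[ v < n ] sumMap (H v) (funs a n)
      ≡⟨ sum-cong-≗ first-vertex ⟩
    colouredListings N (suc a) R st α ∎
    where
    K : V → Fin N → Bool
    K v c = colourOK st v c ∧ (1 ≤ᵇ α c)
    H : V → (Fin a → V) → ℕ
    H v f = ((v ∈ᵇ R) ∧ injectsInto (R ∖ v) f) ⊙ ∑[ c < N ] (K v c ⊙ countColourings N (just (v , c)) f (lowerAt α c 1))
    first-vertex : ∀ v → sumMap (H v) (funs a n)
      ≡ (v ∈ᵇ R) ⊙ ∑[ c < N ] (K v c ⊙ colouredListings N a (R ∖ v) (just (v , c)) (lowerAt α c 1))
    first-vertex v = begin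
      sumMap (H v) (funs a n)
        ≡⟨ sumMap-cong (funs a n) (λ f → trans (∧-⊙ (v ∈ᵇ R) _ _) (cong ((v ∈ᵇ R) ⊙_)
             (trans (⊙-distrib-∑ (injectsInto (R ∖ v) f) {N} _)
                    (sum-cong-≗ (λ c → ⊙-comm (injectsInto (R ∖ v) f) (K v c) _))))) ⟩
      sumMap (λ f → (v ∈ᵇ R) ⊙ ∑[ c < N ] T f c) (funs a n)
        ≡⟨ sym (⊙-distrib-sumMap (v ∈ᵇ R) _ (funs a n)) ⟩
      (v ∈ᵇ R) ⊙ sumMap (λ f → ∑[ c < N ] T f c) (funs a n)
        ≡⟨ cong ((v ∈ᵇ R) ⊙_) (trans (sumMap-∑ T (funs a n)) (sum-cong-≗ λ c →
             trans (sym (⊙-distrib-sumMap (K v c) _ (funs a n)))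
                   (cong (K v c ⊙_) (countColouredListings≡colouredListings N a (R ∖ v) (just (v , c)) (lowerAt α c 1))))) ⟩
      (v ∈ᵇ R) ⊙ ∑[ c < N ] (K v c ⊙ colouredListings N a (R ∖ v) (just (v , c)) (lowerAt α c 1)) ∎
      where
      T : (Fin a → V) → Fin N → ℕ
      T f c = K v c ⊙ injectsInto (R ∖ v) f ⊙ countColourings N (just (v , c)) f (lowerAt α c 1)

  adjacentOK : ∀ {N a} → (Fin a → V) → (Fin a → Fin N) → Fin a × Fin a → Bool
  adjacentOK π s (j , j′) = colourOK (just (π j , s j)) (π j′) (s j′)

  all-adjPairs : ∀ {N} a (π : Fin a → V) (s : Fin a → Fin N) → all (adjacentOK π s) (adjPairs a) ≡ compatibleAfter nothing π s
  all-adjPairs zero    π s = refl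
  all-adjPairs (suc a) π s = after-first a π s
    where
    after-first : ∀ a (π : Fin (suc a) → V) (s : Fin (suc a) → Fin _) →
      all (adjacentOK π s) (adjPairs (suc a)) ≡ compatibleAfter (just (π zero , s zero)) (π ∘ suc) (s ∘ suc)
    after-first zero    π s = refl
    after-first (suc a) π s = cong (adjacentOK π s (zero , suc zero) ∧_) (begin
      all (adjacentOK π s) (map (λ k → Fin.inject₁ k , Fin.suc k) (tabulate Fin.suc))
        ≡⟨ cong (all (adjacentOK π s)) (map-tabulate Fin.suc (λ k → Fin.inject₁ k , Fin.suc k)) ⟩
      all (adjacentOK π s) (tabulate (λ k → Fin.inject₁ (Fin.suc k) , Fin.suc (Fin.suc k)))
        ≡⟨ all-tabulate (adjacentOK π s) (λ k → Fin.inject₁ (Fin.suc k) , Fin.suc (Fin.suc k)) ⟩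
      all (λ k → adjacentOK (π ∘ suc) (s ∘ suc) (Fin.inject₁ k , Fin.suc k)) (allFin a)
        ≡⟨ sym (trans (cong (all (adjacentOK (π ∘ suc) (s ∘ suc))) (map-tabulate id (λ k → Fin.inject₁ k , Fin.suc k)))
                      (all-tabulate (adjacentOK (π ∘ suc) (s ∘ suc)) (λ k → Fin.inject₁ k , Fin.suc k))) ⟩
      all (adjacentOK (π ∘ suc) (s ∘ suc)) (adjPairs (suc a))
        ≡⟨ after-first a (π ∘ suc) (s ∘ suc) ⟩
      compatibleAfter (just (π (suc zero) , s (suc zero))) (π ∘ Fin.suc ∘ Fin.suc) (s ∘ Fin.suc ∘ Fin.suc) ∎)

  coeffU≡coeffUOn : ∀ N α → coeffU X N α ≡ coeffUOn (allFin n) N α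
  coeffU≡coeffUOn N α = begin
    coeffU X N α
      ≡⟨ sumMap-cong (funs n n) (λ π → cong₂ _⊙_ (injB≡injectsInto π) (count-cong (funs n N) λ s →
           cong₂ _∧_ (trans (all-cong (adjPairs n) (λ { (j , j′) → refl })) (all-adjPairs n π s))
                     (hasContent≡contentIs s α))) ⟩
    countColouredListings N n (allFin n) nothing α
      ≡⟨ countColouredListings≡colouredListings N n (allFin n) nothing α ⟩
    colouredListings N n (allFin n) nothing α
      ≡⟨ cong (λ a → colouredListings N a (allFin n) nothing α) (sym (length-tabulate {n = n} id)) ⟩
    colouredListings N (length (allFin n)) (allFin n) nothing α
      ≡⟨ colouredListings≡coeffUOn N (allFin n) α (NoDup-allFin n) ⟩
    coeffUOn (allFin n) N α ∎

  -- [x^α] (p_p · U_R)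
  coeffpU : ℕ → List V → (N : ℕ) → (Fin N → ℕ) → ℕ
  coeffpU p R N α = ∑[ k < N ] ((p ≤ᵇ α k) ⊙ coeffUOn R N (lowerAt α k p))

  firstBlock-past-v₀ : ∀ R v₀ b m (H : List V → ℕ) →
    sumRuns R (v₀ ∷ []) nothing b (λ R′ → sumRuns (R′ ∖ v₀) [] (just v₀) m H)
      ≡ sumRuns (R ∖ v₀) [] (just v₀) m (λ R″ → sumRuns R″ [] nothing b H)
  firstBlock-past-v₀ R v₀ b m H = trans (sumRuns-forbid R v₀ [] nothing b (λ R″ → sumRuns R″ [] (just v₀) m H))
                                       (sumRuns-comm (R ∖ v₀) [] nothing b [] (just v₀) m H)

  SourceOf : ℕ → V → ℕ → List V → Set
  SourceOf M v₀ _ R = (v₀ ∈ᵇ R) ≡ true × IsSource R v₀ × length R ≤ M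

  SourceOf-∖ : ∀ M v₀ a R v → SourceOf M v₀ (suc a) R → (v ∈ᵇ R) ≡ true → (v ∈ᵇ v₀ ∷ []) ≡ false →
               SourceOf M v₀ a (R ∖ v)
  SourceOf-∖ M v₀ a R v (v₀∈R , src , |R|≤M) _ v∉[v₀] =
    trans (∈ᵇ-∖ v₀ v R) (cong₂ (λ p q → p ∧ not q) v₀∈R (trans (==-sym v₀ v) (∨-conicalˡ (v == v₀) false v∉[v₀]))) ,
    IsSource-∖ {R} v src ,
    ≤-trans (length-∖-≤ v R) |R|≤M

  coeffUOn-source : ∀ v₀ N R α M → SourceOf M v₀ 0 R →
    coeffUOn R N α ≡ sumBelow M (λ m → sumRuns (R ∖ v₀) [] (just v₀) m (λ R″ → coeffpU (suc m) R″ N α))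
  coeffUOn-source v₀ zero (u ∷ R) α M _ =
    sym (trans (sumBelow-cong M (λ m _ → sumRuns-zero ((u ∷ R) ∖ v₀) [] (just v₀) m)) (sum-replicate-zero M))
  coeffUOn-source v₀ (suc N) R α M source@(v₀∈R , src , |R|≤M) = begin
    sumRuns R [] nothing a G
      ≡⟨ sumRuns-split v₀ R [] nothing a G v₀∈R refl src refl ⟩
    sumRuns R (v₀ ∷ []) nothing a G
      + sumBelow a (λ m → sumRuns R (v₀ ∷ []) nothing (a ∸ suc m) (λ R′ → sumRuns (R′ ∖ v₀) [] (just v₀) m G))
      ≡⟨ cong₂ _+_ v₀-not-in-first-block v₀-in-first-block ⟩
    sumBelow M later + sumBelow M (λ m → (m <ᵇ a) ⊙ first m)
      ≡⟨ +-comm (sumBelow M later) _ ⟩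
    sumBelow M (λ m → (m <ᵇ a) ⊙ first m) + sumBelow M later
      ≡⟨ sym (∑-distrib-+ {M} _ _) ⟩
    sumBelow M (λ m → (m <ᵇ a) ⊙ first m + later m)
      ≡⟨ sumBelow-cong M (λ m _ → sym (trans (sumRuns-+ (R ∖ v₀) [] (just v₀) m (λ R″ → (m <ᵇ a) ⊙ first-block m R″) _)
                                       (cong (_+ later m) (sumRuns-⊙ (R ∖ v₀) [] (just v₀) m (m <ᵇ a) (first-block m))))) ⟩
    sumBelow M (λ m → sumRuns (R ∖ v₀) [] (just v₀) m (λ R″ → coeffpU (suc m) R″ (suc N) α)) ∎
    where
    a : ℕ
    a = α zero
    G : List V → ℕ
    G R′ = coeffUOn R′ N (α ∘ suc)
    first-block : ℕ → List V → ℕ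
    first-block m R″ = coeffUOn R″ (suc N) (lowerAt α zero (suc m))
    first : ℕ → ℕ
    first m = sumRuns (R ∖ v₀) [] (just v₀) m (first-block m)
    later-blocks : ℕ → List V → ℕ
    later-blocks p R″ = ∑[ k < N ] ((p ≤ᵇ α (suc k)) ⊙ coeffUOn R″ (suc N) (lowerAt α (suc k) p))
    later : ℕ → ℕ
    later m = sumRuns (R ∖ v₀) [] (just v₀) m (later-blocks (suc m))

    first-block-then-p : ∀ p R″ → sumRuns R″ [] nothing a (λ R‴ → coeffpU p R‴ N (α ∘ suc)) ≡ later-blocks p R″
    first-block-then-p p R″ = trans (sumRuns-∑ R″ [] nothing a {N} _)
      (sum-cong-≗ (λ k → sumRuns-⊙ R″ [] nothing a (p ≤ᵇ α (suc k)) _))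

    v₀-not-in-first-block : sumRuns R (v₀ ∷ []) nothing a G ≡ sumBelow M later
    v₀-not-in-first-block = begin
      sumRuns R (v₀ ∷ []) nothing a G
        ≡⟨ sumRuns-cong-inv (SourceOf M v₀) (v₀ ∷ []) (SourceOf-∖ M v₀) R nothing a source
             (λ R′ source′ → coeffUOn-source v₀ N R′ (α ∘ suc) M source′) ⟩
      sumRuns R (v₀ ∷ []) nothing a (λ R′ → sumBelow M (λ m → run-then-p m R′))
        ≡⟨ sumRuns-sumBelow R (v₀ ∷ []) nothing a M run-then-p ⟩
      sumBelow M (λ m → sumRuns R (v₀ ∷ []) nothing a (run-then-p m))
        ≡⟨ sumBelow-cong M (λ m _ → trans (firstBlock-past-v₀ R v₀ a m _)
             (sumRuns-cong (R ∖ v₀) [] (just v₀) m (first-block-then-p (suc m)))) ⟩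
      sumBelow M later ∎
      where
      run-then-p : ℕ → List V → ℕ
      run-then-p m R′ = sumRuns (R′ ∖ v₀) [] (just v₀) m (λ R″ → coeffpU (suc m) R″ N (α ∘ suc))

    v₀-in-first-block :
      sumBelow a (λ m → sumRuns R (v₀ ∷ []) nothing (a ∸ suc m) (λ R′ → sumRuns (R′ ∖ v₀) [] (just v₀) m G))
        ≡ sumBelow M (λ m → (m <ᵇ a) ⊙ first m)
    v₀-in-first-block = trans (sumBelow-cong a (λ m _ → firstBlock-past-v₀ R v₀ (a ∸ suc m) m G))
      (sumBelow-extend a M first (λ m M≤m → sumRuns-vanish (R ∖ v₀) [] (just v₀) m (first-block m)
        (≤-trans (length-∖-< v₀ R v₀∈R) (≤-trans |R|≤M M≤m))))

  -- Sources

  record BackwardWalk : Set where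
    field
      walk     : ℕ → V
      backEdge : ∀ k → Edge X (walk (suc k)) (walk k)
      loopless : ∀ k → walk (suc k) ≢ walk k

  dropWalk : ℕ → BackwardWalk → BackwardWalk
  dropWalk zero    W = W
  dropWalk (suc p) W = dropWalk p (record { walk = walk ∘ suc ; backEdge = backEdge ∘ suc ; loopless = loopless ∘ suc })
    where open BackwardWalk W

  walk-drop : ∀ p W k → BackwardWalk.walk (dropWalk p W) k ≡ BackwardWalk.walk W (p + k)
  walk-drop zero    W k = refl
  walk-drop (suc p) W k = walk-drop p _ k

  module _ (W : BackwardWalk) where
    open BackwardWalk W

    -- Read backwards, the closed walk walk (m + 2), …, walk 1 is a cycle once its vertices are distinct.
    distinct-closedWalk⇒cycle : ∀ m → walk 0 ≡ walk (suc (suc m)) →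
      (∀ a b → a ≤ suc m → b ≤ suc m → walk (suc a) ≡ walk (suc b) → a ≡ b) → DirectedCycle X m
    distinct-closedWalk⇒cycle m closed distinct = record
      { vtx = vtx ; distinct = vtx-injective ; step = step ; close = close }
      where
      vtx : Fin (suc (suc m)) → V
      vtx t = walk (suc (suc m ∸ toℕ t))

      edge-at : ∀ {u v} k → walk (suc k) ≡ u → walk k ≡ v → Edge X u v
      edge-at k refl refl = backEdge k

      vtx-injective : Injective _≡_ _≡_ vtx
      vtx-injective {t} {t′} eq = Finₚ.toℕ-injective (∸-cancelˡ-≡ (≤-pred (toℕ<n t)) (≤-pred (toℕ<n t′))
        (distinct _ _ (m∸n≤m (suc m) (toℕ t)) (m∸n≤m (suc m) (toℕ t′)) eq))

      step : ∀ i → Edge X (vtx (Fin.inject₁ i)) (vtx (suc i))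
      step i = edge-at (suc (m ∸ toℕ i))
        (cong (λ k → walk (suc k)) (sym (trans (cong (suc m ∸_) (Finₚ.toℕ-inject₁ i)) (+-∸-assoc 1 (≤-pred (toℕ<n i))))))
        refl

      close : Edge X (vtx (Fin.fromℕ (suc m))) (vtx zero)
      close = edge-at 0 (cong (λ k → walk (suc k)) (sym (trans (cong (suc m ∸_) (Finₚ.toℕ-fromℕ (suc m))) (n∸n≡0 (suc m)))))
                        closed

  -- A closed walk contains a cycle: cut it at a repeated vertex until none is left.
  closedWalk⇒cycle : ∀ L (W : BackwardWalk) → BackwardWalk.walk W 0 ≡ BackwardWalk.walk W (suc L) → ∃ (DirectedCycle X)
  closedWalk⇒cycle = <-rec _ λ L shorter W closed → cut L shorter W closed
    where
    cut : ∀ L → (∀ {L′} → L′ < L → ∀ W → BackwardWalk.walk W 0 ≡ BackwardWalk.walk W (suc L′) → ∃ (DirectedCycle X)) →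
          ∀ W → BackwardWalk.walk W 0 ≡ BackwardWalk.walk W (suc L) → ∃ (DirectedCycle X)
    cut L shorter W closed with any? (λ (i : Fin (suc L)) → any? λ (j : Fin (suc L)) →
                                  (toℕ i <? toℕ j) ×-dec (walk (suc (toℕ i)) Fin.≟ walk (suc (toℕ j))))
      where open BackwardWalk W
    ... | yes (i , j , i<j , repeat) =
      shorter L′<L (dropWalk (suc (toℕ i)) W) (begin
        walk (dropWalk (suc (toℕ i)) W) 0          ≡⟨ walk-drop (suc (toℕ i)) W 0 ⟩
        walk W (suc (toℕ i) + 0)                   ≡⟨ cong (walk W ∘ suc) (+-identityʳ (toℕ i)) ⟩
        walk W (suc (toℕ i))                       ≡⟨ repeat ⟩
        walk W (suc (toℕ j))                       ≡⟨ cong (walk W ∘ suc) (sym i+[1+L′]≡j) ⟩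
        walk W (suc (toℕ i) + suc L′)              ≡⟨ sym (walk-drop (suc (toℕ i)) W (suc L′)) ⟩
        walk (dropWalk (suc (toℕ i)) W) (suc L′)   ∎)
      where
      open BackwardWalk using (walk)
      L′ : ℕ
      L′ = toℕ j ∸ suc (toℕ i)
      i+[1+L′]≡j : toℕ i + suc L′ ≡ toℕ j
      i+[1+L′]≡j = trans (+-suc (toℕ i) L′) (m+[n∸m]≡n i<j)
      L′<L : L′ < L
      L′<L = <-≤-trans (s≤s (m≤n+m L′ (toℕ i))) (subst (_≤ L) (sym (m+[n∸m]≡n i<j)) (≤-pred (toℕ<n j)))
    ... | no no-repeat with L
    ...   | zero  = ⊥-elim (BackwardWalk.loopless W 0 (sym closed))
    ...   | suc m = m , distinct-closedWalk⇒cycle W m closed distinct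
      where
      open BackwardWalk W
      repeat-at : ∀ {a b} (a≤ : a ≤ suc m) (b≤ : b ≤ suc m) → a < b → walk (suc a) ≡ walk (suc b) →
                  toℕ (Fin.fromℕ< (s≤s a≤)) < toℕ (Fin.fromℕ< (s≤s b≤))
                  × walk (suc (toℕ (Fin.fromℕ< (s≤s a≤)))) ≡ walk (suc (toℕ (Fin.fromℕ< (s≤s b≤))))
      repeat-at a≤ b≤ a<b eq rewrite Finₚ.toℕ-fromℕ< (s≤s a≤) | Finₚ.toℕ-fromℕ< (s≤s b≤) = a<b , eq

      distinct : ∀ a b → a ≤ suc m → b ≤ suc m → walk (suc a) ≡ walk (suc b) → a ≡ b
      distinct a b a≤ b≤ eq with <-cmp a b
      ... | tri< a<b _ _ = ⊥-elim (no-repeat (Fin.fromℕ< (s≤s a≤) , Fin.fromℕ< (s≤s b≤) , repeat-at a≤ b≤ a<b eq))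
      ... | tri≈ _ a≡b _ = a≡b
      ... | tri> _ _ b<a = ⊥-elim (no-repeat (Fin.fromℕ< (s≤s b≤) , Fin.fromℕ< (s≤s a≤) , repeat-at b≤ a≤ b<a (sym eq)))

  edge⇒Edge : ∀ {u v} → edge u v ≡ true → Edge X u v
  edge⇒Edge {u} {v} h with edge? X u v
  ... | yes e = e
  ... | no  _ = ⊥-elim (true≢false (sym h))

  InNeighbour : List V → V → V → Set
  InNeighbour R v u = (u ∈ᵇ R) ≡ true × (u == v) ≡ false × edge u v ≡ true

  inNeighbour? : ∀ R v u → Dec (InNeighbour R v u)
  inNeighbour? R v u = ((u ∈ᵇ R) Boolₚ.≟ true) ×-dec ((u == v) Boolₚ.≟ false) ×-dec (edge u v Boolₚ.≟ true)

  no-inNeighbour⇒IsSource : ∀ R v → ¬ ∃ (InNeighbour R v) → IsSource R v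
  no-inNeighbour⇒IsSource R v none u u∈R u≢v = cong not (¬-not (λ e → none (u , u∈R , u≢v , e)))

  source-exists : NoDirectedCycle≥2 X → ∀ R v → (v ∈ᵇ R) ≡ true → ∃ λ v₀ → (v₀ ∈ᵇ R) ≡ true × IsSource R v₀
  source-exists acyclic R v v∈R with any? (λ u → ((u ∈ᵇ R) Boolₚ.≟ true) ×-dec ¬? (any? (inNeighbour? R u)))
  ... | yes (v₀ , v₀∈R , none) = v₀ , v₀∈R , no-inNeighbour⇒IsSource R v₀ none
  ... | no no-source = ⊥-elim (acyclic _ (proj₂ (closedWalk⇒cycle L (dropWalk (toℕ i) W) closed)))
    where
    InR : Set
    InR = ∃ λ u → (u ∈ᵇ R) ≡ true

    inNeighbourOf : (x : InR) → ∃ (InNeighbour R (proj₁ x))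
    inNeighbourOf (u , u∈R) = decidable-stable (any? (inNeighbour? R u)) (λ none → no-source (u , u∈R , none))

    walkR : ℕ → InR
    walkR zero    = v , v∈R
    walkR (suc k) = let (u , u∈R , _) = inNeighbourOf (walkR k) in u , u∈R

    W : BackwardWalk
    W = record
      { walk     = proj₁ ∘ walkR
      ; backEdge = λ k → edge⇒Edge (proj₂ (proj₂ (proj₂ (inNeighbourOf (walkR k)))))
      ; loopless = λ k → ==-false⇒≢ (proj₁ (proj₂ (proj₂ (inNeighbourOf (walkR k)))))
      }

    repeat : ∃ λ i → ∃ λ j → i Fin.< j × BackwardWalk.walk W (toℕ i) ≡ BackwardWalk.walk W (toℕ j)
    repeat = Finₚ.pigeonhole (n<1+n n) (λ (i : Fin (suc n)) → BackwardWalk.walk W (toℕ i))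
    i j : Fin (suc n)
    i = proj₁ repeat
    j = proj₁ (proj₂ repeat)
    L : ℕ
    L = toℕ j ∸ suc (toℕ i)
    i+[1+L]≡j : toℕ i + suc L ≡ toℕ j
    i+[1+L]≡j = trans (+-suc (toℕ i) L) (m+[n∸m]≡n (proj₁ (proj₂ (proj₂ repeat))))
    closed : BackwardWalk.walk (dropWalk (toℕ i) W) 0 ≡ BackwardWalk.walk (dropWalk (toℕ i) W) (suc L)
    closed = begin
      walk (dropWalk (toℕ i) W) 0         ≡⟨ walk-drop (toℕ i) W 0 ⟩
      walk W (toℕ i + 0)                  ≡⟨ cong (walk W) (+-identityʳ (toℕ i)) ⟩
      walk W (toℕ i)                      ≡⟨ proj₂ (proj₂ (proj₂ repeat)) ⟩
      walk W (toℕ j)                      ≡⟨ cong (walk W) (sym i+[1+L]≡j) ⟩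
      walk W (toℕ i + suc L)              ≡⟨ sym (walk-drop (toℕ i) W (suc L)) ⟩
      walk (dropWalk (toℕ i) W) (suc L)   ∎
      where open BackwardWalk using (walk)

  -- Expansion into power sums

  remainders : List V → List V → Maybe V → ℕ → List (List V)
  remainders R F x zero    = R ∷ []
  remainders R F x (suc a) =
    concatMap (λ v → if admissible R F x v then remainders (R ∖ v) F (just v) a else []) (allFin n)

  sumRuns≡sumMap-remainders : ∀ R F x a G → sumRuns R F x a G ≡ sumMap G (remainders R F x a)
  sumRuns≡sumMap-remainders R F x zero    G = sym (+-identityʳ (G R))
  sumRuns≡sumMap-remainders R F x (suc a) G = sym (begin
    sumMap G (concatMap after (allFin n))  ≡⟨ sumMap-concatMap G after (allFin n) ⟩
    sumMap (sumMap G ∘ after) (allFin n)   ≡⟨ sumMap-allFin (sumMap G ∘ after) ⟩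
    ∑[ v < n ] sumMap G (after v)          ≡⟨ sum-cong-≗ first ⟩
    sumRuns R F x (suc a) G                ∎)
    where
    after : V → List (List V)
    after v = if admissible R F x v then remainders (R ∖ v) F (just v) a else []
    first : ∀ v → sumMap G (after v) ≡ admissible R F x v ⊙ sumRuns (R ∖ v) F (just v) a G
    first v with admissible R F x v
    ... | true  = sym (sumRuns≡sumMap-remainders (R ∖ v) F (just v) a G)
    ... | false = refl

  remainders-length : ∀ R F x a → NoDup R →
                      All (λ R″ → NoDup R″ × length R″ + a ≡ length R) (remainders R F x a)
  remainders-length R F x zero    nd = (nd , +-identityʳ (length R)) ∷ []
  remainders-length R F x (suc a) nd = concat⁺ (map⁺ (tabulate⁺ after))
    where
    after : ∀ v → All (λ R″ → NoDup R″ × length R″ + suc a ≡ length R)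
                      (if admissible R F x v then remainders (R ∖ v) F (just v) a else [])
    after v with admissible R F x v in adm
    ... | false = []
    ... | true  = All.map (λ (nd″ , len) → nd″ , trans (+-suc _ a) (trans (cong suc len) (length-∖ v R nd (∧-true₁ adm))))
                          (remainders-length (R ∖ v) F (just v) a (NoDup-∖ v R nd))

  coeffUOn-[] : ∀ N (α : Fin N → ℕ) → coeffUOn [] N α ≡ isZero α ⊙ 1
  coeffUOn-[] zero    α = refl
  coeffUOn-[] (suc N) α rewrite isZero-suc α with α zero
  ... | zero  = coeffUOn-[] N (α ∘ suc)
  ... | suc b = sumRuns-vanish [] [] nothing (suc b) (λ R′ → coeffUOn R′ N (α ∘ suc)) (s≤s z≤n)

  module _ (acyclic : NoDirectedCycle≥2 X) where

    sourceOf : ∀ u R → ∃ λ v₀ → (v₀ ∈ᵇ u ∷ R) ≡ true × IsSource (u ∷ R) v₀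
    sourceOf u R = source-exists acyclic (u ∷ R) u (cong (_∨ (u ∈ᵇ R)) (==-refl u))

    source : V → List V → V
    source u R = proj₁ (sourceOf u R)

    source-∈ : ∀ u R → (source u R ∈ᵇ u ∷ R) ≡ true
    source-∈ u R = proj₁ (proj₂ (sourceOf u R))

    length-∖-source : ∀ u R {f} → length (u ∷ R) ≤ suc f → length ((u ∷ R) ∖ source u R) ≤ f
    length-∖-source u R |R|≤f = ≤-pred (≤-trans (length-∖-< (source u R) (u ∷ R) (source-∈ u R)) |R|≤f)

    withFirstPart : (List V → List (List ℕ)) → ∀ u R → Fin (length (u ∷ R)) → List (List ℕ)
    withFirstPart rest u R m = concatMap (λ R″ → map (suc (toℕ m) ∷_) (rest R″))
                                         (remainders ((u ∷ R) ∖ source u R) [] (just (source u R)) (toℕ m))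

    -- Part sizes of the successive runs removed by the source recurrence; f is fuel, f ≥ length R.
    compositions : ℕ → List V → List (List ℕ)
    compositions _       []      = [] ∷ []
    compositions zero    (u ∷ R) = []
    compositions (suc f) (u ∷ R) = concatMap (withFirstPart (compositions f) u R) (allFin (length (u ∷ R)))

    coeffUOn-compositions : ∀ f R → NoDup R → length R ≤ f → ∀ N α →
                            coeffUOn R N α ≡ sumMap (λ λs → coeffP λs N α) (compositions f R)
    coeffUOn-compositions f       []      _  _     N α = trans (coeffUOn-[] N α) (sym (+-identityʳ _))
    coeffUOn-compositions (suc f) (u ∷ R) nd |R|≤f N α = begin
      coeffUOn (u ∷ R) N α
        ≡⟨ coeffUOn-source v₀ N (u ∷ R) α M (source-∈ u R , proj₂ (proj₂ (sourceOf u R)) , ≤-refl) ⟩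
      sumBelow M (λ m → sumRuns R₀ [] (just v₀) m (λ R″ → coeffpU (suc m) R″ N α))
        ≡⟨ sumBelow-cong M (λ m _ → trans
             (sumRuns-cong-inv Small [] (λ _ R′ v (nd′ , ≤f) _ _ → NoDup-∖ v R′ nd′ , ≤-trans (length-∖-≤ v R′) ≤f)
                               R₀ (just v₀) m (NoDup-∖ v₀ (u ∷ R) nd , length-∖-source u R |R|≤f)
                               (λ R″ (nd″ , ≤f) → p-times-U m R″ nd″ ≤f))
             (sumRuns≡sumMap-remainders R₀ [] (just v₀) m _)) ⟩
      sumBelow M (λ m → sumMap (λ R″ → coeffP-α-sum (map (suc m ∷_) (compositions f R″))) (remainders R₀ [] (just v₀) m))
        ≡⟨ sym (trans (sumMap-concatMap coeffP-α (withFirstPart (compositions f) u R) (allFin M))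
                      (trans (sumMap-allFin {m = M} (coeffP-α-sum ∘ withFirstPart (compositions f) u R))
                             (sum-cong-≗ {M} (λ m → sumMap-concatMap coeffP-α (λ R″ → map (suc (toℕ m) ∷_) (compositions f R″))
                                                                       (remainders R₀ [] (just v₀) (toℕ m)))))) ⟩
      coeffP-α-sum (compositions (suc f) (u ∷ R)) ∎
      where
      M : ℕ
      M = length (u ∷ R)
      v₀ : V
      v₀ = source u R
      R₀ : List V
      R₀ = (u ∷ R) ∖ v₀
      coeffP-α : List ℕ → ℕ
      coeffP-α λs = coeffP λs N α
      coeffP-α-sum : List (List ℕ) → ℕ
      coeffP-α-sum = sumMap coeffP-α

      Small : ℕ → List V → Set
      Small _ R″ = NoDup R″ × length R″ ≤ f

      p-times-U : ∀ m R″ → NoDup R″ → length R″ ≤ f →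
                  coeffpU (suc m) R″ N α ≡ coeffP-α-sum (map (suc m ∷_) (compositions f R″))
      p-times-U m R″ nd″ ≤f = sym (begin
        coeffP-α-sum (map (suc m ∷_) (compositions f R″))
          ≡⟨ sumMap-map coeffP-α (suc m ∷_) (compositions f R″) ⟩
        sumMap (λ λs → coeffP (suc m ∷ λs) N α) (compositions f R″)
          ≡⟨ sumMap-cong (compositions f R″) (λ λs → coeffP-cons (suc m) λs N α) ⟩
        sumMap (λ λs → ∑[ k < N ] ((suc m ≤ᵇ α k) ⊙ coeffP λs N (lowerAt α k (suc m)))) (compositions f R″)
          ≡⟨ sumMap-∑ (λ λs k → (suc m ≤ᵇ α k) ⊙ coeffP λs N (lowerAt α k (suc m))) (compositions f R″) ⟩
        ∑[ k < N ] sumMap (λ λs → (suc m ≤ᵇ α k) ⊙ coeffP λs N (lowerAt α k (suc m))) (compositions f R″)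
          ≡⟨ sum-cong-≗ (λ k → trans (sym (⊙-distrib-sumMap (suc m ≤ᵇ α k) _ (compositions f R″)))
               (cong ((suc m ≤ᵇ α k) ⊙_) (sym (coeffUOn-compositions f R″ nd″ ≤f N (lowerAt α k (suc m)))))) ⟩
        coeffpU (suc m) R″ N α ∎)

    compositions-valid : ∀ f R → NoDup R → length R ≤ f →
                         All (λ λs → All (1 ≤_) λs × sumℕ λs ≡ length R) (compositions f R)
    compositions-valid f       []      _  _     = ([] , refl) ∷ []
    compositions-valid (suc f) (u ∷ R) nd |R|≤f =
      All-concatMap⁺ (withFirstPart (compositions f) u R) (tabulate⁺ {f = id} λ m →
        All-concatMap⁺ (λ R″ → map (suc (toℕ m) ∷_) (compositions f R″))
          (All.map (λ {R″} (nd″ , |R″|) → map⁺ (All.map (extend m R″ |R″|)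
                      (compositions-valid f R″ nd″
                         (≤-trans (m≤m+n _ (toℕ m)) (subst (_≤ f) (sym |R″|) (length-∖-source u R |R|≤f))))))
                   (remainders-length R₀ [] (just v₀) (toℕ m) (NoDup-∖ v₀ (u ∷ R) nd))))
      where
      v₀ : V
      v₀ = source u R
      R₀ : List V
      R₀ = (u ∷ R) ∖ v₀
      extend : ∀ m R″ → length R″ + toℕ m ≡ length R₀ → ∀ {λs} → All (1 ≤_) λs × sumℕ λs ≡ length R″ →
               All (1 ≤_) (suc (toℕ m) ∷ λs) × sumℕ (suc (toℕ m) ∷ λs) ≡ length (u ∷ R)
      extend m R″ |R″| {λs} (pos , sum≡) = s≤s z≤n ∷ pos , (begin
        suc (toℕ m + sumℕ λs)      ≡⟨ cong (λ k → suc (toℕ m + k)) sum≡ ⟩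
        suc (toℕ m + length R″)    ≡⟨ cong suc (trans (+-comm (toℕ m) (length R″)) |R″|) ⟩
        suc (length R₀)            ≡⟨ length-∖ v₀ (u ∷ R) nd (source-∈ u R) ⟩
        length (u ∷ R)             ∎)

toℚ-+ : ∀ a b → toℚ (a + b) ≡ toℚ a ℚ.+ toℚ b
toℚ-+ a b = ℚₚ.toℚᵘ-injective (ℚᵘₚ.≃-trans integral (ℚᵘₚ.≃-sym (ℚₚ.toℚᵘ-homo-+ (toℚ a) (toℚ b))))
  where
  toℚᵘ-toℚ : ∀ k → ℚ.toℚᵘ (toℚ k) ≡ mkℚᵘ (ℤ.+ k) 0
  toℚᵘ-toℚ k = cong ℚ.toℚᵘ (ℚₚ.normalize-coprime (Coprimeₚ.sym (Coprimeₚ.1-coprimeTo k)))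

  integral : ℚ.toℚᵘ (toℚ (a + b)) ℚᵘ.≃ ℚ.toℚᵘ (toℚ a) ℚᵘ.+ ℚ.toℚᵘ (toℚ b)
  integral rewrite toℚᵘ-toℚ (a + b) | toℚᵘ-toℚ a | toℚᵘ-toℚ b = ℚᵘ.*≡* (trans (ℤₚ.*-identityʳ _)
    (sym (trans (ℤₚ.*-identityʳ _) (cong₂ ℤ._+_ (ℤₚ.*-identityʳ (ℤ.+ a)) (ℤₚ.*-identityʳ (ℤ.+ b))))))

p-positive : ∀ {n} (X : Digraph n) → NoDirectedCycle≥2 X → PPositive X
p-positive {n} X acyclic = map (λ λs → sort λs , 1ℚ) comps , valid , expansion
  where
  open Expansion X
  comps : List (List ℕ)
  comps = compositions acyclic n (allFin n)
  |allFin|≡n : length (allFin n) ≡ n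
  |allFin|≡n = length-tabulate id
  |allFin|≤n : length (allFin n) ≤ n
  |allFin|≤n = ≤-reflexive |allFin|≡n

  valid : All (λ { (λs , c) → IsPartition n λs × 0ℚ ℚ.≤ c }) (map (λ λs → sort λs , 1ℚ) comps)
  valid = map⁺ (All.map (λ {λs} (pos , sum≡) →
      (All-resp-↭ (↭-sym (sort-↭ λs)) pos , sort-↗ λs , trans (sum-↭ (sort-↭ λs)) (trans sum≡ |allFin|≡n)) ,
      ℚₚ.nonNegative⁻¹ 1ℚ)
    (compositions-valid acyclic n (allFin n) (NoDup-allFin n) |allFin|≤n))

  expansion : ∀ N α → toℚ (coeffU X N α)
                      ≡ sumℚ (map (λ { (λs , c) → c ℚ.* toℚ (coeffP λs N α) }) (map (λ λs → sort λs , 1ℚ) comps))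
  expansion N α = trans
    (cong toℚ (trans (coeffU≡coeffUOn N α) (coeffUOn-compositions acyclic n (allFin n) (NoDup-allFin n) |allFin|≤n N α)))
    (sorted comps)
    where
    sorted : ∀ xs → toℚ (sumMap (λ λs → coeffP λs N α) xs)
                    ≡ sumℚ (map (λ { (λs , c) → c ℚ.* toℚ (coeffP λs N α) }) (map (λ λs → sort λs , 1ℚ) xs))
    sorted []         = refl
    sorted (λs ∷ λss) = trans (toℚ-+ (coeffP λs N α) _) (cong₂ ℚ._+_
      (sym (trans (ℚₚ.*-identityˡ _) (cong toℚ (coeffP-↭ (sort-↭ λs) N α)))) (sorted λss))

chain-trans : ∀ {ℓ} (_≺_ : Rel A ℓ) → Transitive _≺_ → ∀ m (v : Fin (suc (suc m)) → A) →
              (∀ (i : Fin (suc m)) → v (Fin.inject₁ i) ≺ v (suc i)) → v zero ≺ v (Fin.fromℕ (suc m))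
chain-trans _≺_ ≺-trans zero    v step = step zero
chain-trans _≺_ ≺-trans (suc m) v step =
  ≺-trans (chain-trans _≺_ ≺-trans m (v ∘ Fin.inject₁) (step ∘ Fin.inject₁)) (step (Fin.fromℕ (suc m)))

permDigraph-acyclic : ∀ {n} (σ : Permutation′ n) → NoDirectedCycle≥2 (permDigraph σ)
permDigraph-acyclic σ m cycle =
  Finₚ.<-irrefl refl (Finₚ.<-trans (chain-trans Fin._<_ Finₚ.<-trans m vtx (proj₁ ∘ step)) (proj₁ close))
  where open DirectedCycle cycle

posetDigraph-acyclic : ∀ {n} (P : FinPoset n) → NoDirectedCycle≥2 (posetDigraph P)
posetDigraph-acyclic P m cycle =
  last≢first (distinct (antisym (proj₁ close) (chain-trans (_≤P_ P) trans′ m vtx (proj₁ ∘ step))))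
  where
  open DirectedCycle cycle
  open IsPartialOrder (isPO P) using (antisym) renaming (trans to trans′)
  last≢first : Fin.fromℕ (suc m) ≢ zero
  last≢first ()

mainTheorem5 : ((n : ℕ) (D : Digraph n) → NoDirectedCycle≥2 D → PPositive D)
               × ((n : ℕ) (σ : Permutation′ n) → PPositive (permDigraph σ))
               × ((n : ℕ) (P : FinPoset n) → PPositive (posetDigraph P))
mainTheorem5 =
  (λ n D → p-positive D) ,
  (λ n σ → p-positive (permDigraph σ) (permDigraph-acyclic σ)) ,
  (λ n P → p-positive (posetDigraph P) (posetDigraph-acyclic P))
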